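{- If $G$ is a $K_4$-minor-free graph that has no nontrivial 2-cut, then $G$ is outerplanar.
   Context: All graphs are simple and finite. For $S\subseteq V(G)$, a nontrivial $S$-bridge is a component of $G-S$ together with all edges joining it to $S$. For two vertices $u,v$, $c(G,uv)$ denotes the number of nontrivial $\{u,v\}$-bridges that contain both $u$ and $v$; a nontrivial 2-cut is a set $\{u,v\}$ of two vertices with $c(G,uv)\ge 3$. A graph is $K_4$-minor-free if no graph isomorphic to $K_4$ can be obtained from it by edge contractions, edge deletions and vertex deletions. -}

module Defs where

open import Data.Nat using (ℕ; zero; suc)
open import Data.Fin using (Fin; punchIn; _<_)
open import Data.Fin.Properties using (_≟_)
open import Data.Bool using (Bool; true; false)
open import Data.Product using (Σ; ∃; _×_; _,_)
open import Data.Sum using (_⊎_)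
open import Data.Empty using (⊥)
open import Function.Bundles using (_↔_; Inverse)
open import Relation.Nullary using (¬_; yes; no)
open import Relation.Binary.PropositionalEquality using (_≡_; _≢_; refl)
open import Relation.Binary.Construct.Closure.ReflexiveTransitive using (Star)

record Graph (n : ℕ) : Set where
  field
    adj    : Fin n → Fin n → Bool
    sym    : ∀ i j → adj i j ≡ adj j i
    irrefl : ∀ i → adj i i ≡ false
open Graph public

Adj : ∀ {n} → Graph n → Fin n → Fin n → Set
Adj G i j = adj G i j ≡ true

completeAdj : ∀ {n} → Fin n → Fin n → Bool
completeAdj i j with i ≟ j
... | yes _ = false
... | no  _ = true

private
  completeSym : ∀ {n} (i j : Fin n) → completeAdj i j ≡ completeAdj j i
  completeSym i j with i ≟ j | j ≟ i
  ... | yes _ | yes _ = refl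
  ... | no  _ | no  _ = refl
  ... | yes refl | no  q with q refl
  ... | ()
  completeSym i j | no p | yes refl with p refl
  ... | ()

  completeIrrefl : ∀ {n} (i : Fin n) → completeAdj i i ≡ false
  completeIrrefl i with i ≟ i
  ... | yes _ = refl
  ... | no  p with p refl
  ... | ()

complete : (n : ℕ) → Graph n
complete n = record { adj = completeAdj ; sym = completeSym ; irrefl = completeIrrefl }

K4 : Graph 4
K4 = complete 4

Iso : ∀ {n} → Graph n → Graph n → Set
Iso {n} G H = Σ (Fin n ↔ Fin n) λ σ →
  ∀ i j → adj H (Inverse.to σ i) (Inverse.to σ j) ≡ adj G i j

AnyGraph : Set
AnyGraph = Σ ℕ Graph

deleteVertex : ∀ {n} → Graph (suc n) → Fin (suc n) → Graph n
deleteVertex G v = record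
  { adj    = λ i j → adj G (punchIn v i) (punchIn v j)
  ; sym    = λ i j → sym G (punchIn v i) (punchIn v j)
  ; irrefl = λ i → irrefl G (punchIn v i)
  }

SpanningSubgraph : ∀ {n} → Graph n → Graph n → Set
SpanningSubgraph H G = ∀ i j → Adj H i j → Adj G i j

-- H is obtained from G by contracting the edge {v , punchIn v u}:
-- the vertex v is merged into the vertex punchIn v u (which becomes u in H);
-- loops are discarded and parallel edges identified (simple graphs).
Contraction : ∀ {n} → Graph (suc n) → Graph n → Set
Contraction {n} G H = Σ (Fin (suc n)) λ v → Σ (Fin n) λ u →
  Adj G v (punchIn v u) ×
  (∀ i j → i ≢ j →
     (Adj H i j → (Adj G (punchIn v i) (punchIn v j)
                   ⊎ ((i ≡ u × Adj G v (punchIn v j))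
                   ⊎ (j ≡ u × Adj G (punchIn v i) v)))) ×
     ((Adj G (punchIn v i) (punchIn v j)
       ⊎ ((i ≡ u × Adj G v (punchIn v j))
       ⊎ (j ≡ u × Adj G (punchIn v i) v))) → Adj H i j))

data MinorStep : AnyGraph → AnyGraph → Set where
  delVertex : ∀ {n} (G : Graph (suc n)) (v : Fin (suc n)) →
              MinorStep (suc n , G) (n , deleteVertex G v)
  delEdges  : ∀ {n} (G H : Graph n) → SpanningSubgraph H G →
              MinorStep (n , G) (n , H)
  contract  : ∀ {n} (G : Graph (suc n)) (H : Graph n) → Contraction G H →
              MinorStep (suc n , G) (n , H)

HasK4Minor : ∀ {n} → Graph n → Set
HasK4Minor {n} G = Σ (Graph 4) λ H → Star MinorStep (n , G) (4 , H) × Iso H K4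

K4MinorFree : ∀ {n} → Graph n → Set
K4MinorFree G = ¬ HasK4Minor G

EdgeAvoiding : ∀ {n} → Graph n → Fin n → Fin n → Fin n → Fin n → Set
EdgeAvoiding G u v a b =
  Adj G a b × (a ≢ u × a ≢ v) × (b ≢ u × b ≢ v)

ConnectedAvoiding : ∀ {n} → Graph n → Fin n → Fin n → Fin n → Fin n → Set
ConnectedAvoiding G u v = Star (EdgeAvoiding G u v)

ComponentTouches : ∀ {n} → Graph n → Fin n → Fin n → Fin n → Fin n → Set
ComponentTouches G u v x w =
  ∃ λ y → ConnectedAvoiding G u v x y × Adj G y w

-- x is a vertex of G - {u , v} whose {u , v}-bridge contains both u and v
BridgeRep : ∀ {n} → Graph n → Fin n → Fin n → Fin n → Set
BridgeRep G u v x =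
  (x ≢ u × x ≢ v) × ComponentTouches G u v x u × ComponentTouches G u v x v

-- c(G, uv) ≥ 3 : three distinct components of G - {u , v}, each of whose
-- bridges contains both u and v
NontrivialTwoCut : ∀ {n} → Graph n → Fin n → Fin n → Set
NontrivialTwoCut G u v =
  u ≢ v × ∃ λ x → ∃ λ y → ∃ λ z →
    (BridgeRep G u v x × BridgeRep G u v y × BridgeRep G u v z) ×
    (¬ ConnectedAvoiding G u v x y × ¬ ConnectedAvoiding G u v x z
       × ¬ ConnectedAvoiding G u v y z)

-- Outerplanarity: the vertices can be placed in convex position (on a
-- circle, in the cyclic order given by pos) so that no two edges, drawn as
-- chords, cross.  Chords {a,b} and {c,d} cross iff their endpoints
-- interleave: pos a < pos c < pos b < pos d.

Outerplanar : ∀ {n} → Graph n → Set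
Outerplanar {n} G = Σ (Fin n ↔ Fin n) λ pos →
  ∀ a b c d → Adj G a b → Adj G c d →
    ¬ (Inverse.to pos a < Inverse.to pos c ×
       Inverse.to pos c < Inverse.to pos b ×
       Inverse.to pos b < Inverse.to pos d)

{-# OPTIONS --safe #-}

-- We draw G with its vertices at distinct points of a line (read cyclically: in convex position)
-- and no two edges crossing, by induction on the number of vertices.
-- A graph of minimum degree three has a K4 minor: contract an edge without common neighbour; if
-- there is none and all degrees are at least four, delete a vertex; otherwise a vertex of degree
-- three and its neighbours span a K4 or can be contracted, after deleting at most one vertex, to a
-- smaller graph of minimum degree three.  So G has a vertex w of degree at most two.
-- If w has at most one neighbour a, delete w, draw the rest with a leftmost and append w.
-- If w has neighbours a ≠ b, contract w into a.  The result H contains the edge ab and has no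
-- nontrivial 2-cut, and since w alone is an {a,b}-bridge of G, the vertices of H - {a,b} whose
-- bridge contains both a and b form one component.  In a drawing of H this component lies on one
-- side of the chord ab, and the bridges attached to only one of a, b can be moved next to that
-- vertex; so H has a drawing with a and b at the two ends, and w is appended.
module Submission where

open import Defs
open import Data.Bool.Base using (true; if_then_else_)
import Data.Bool.Properties as Bool
open import Data.Empty using (⊥; ⊥-elim)
open import Data.Fin.Base using (Fin; zero; suc; punchIn; punchOut; toℕ; fromℕ<)
open import Data.Fin.Patterns using (0F; 1F; 2F; 3F)
open import Data.Fin.Properties
  using ( _≟_; any?; all?; ¬∀⟶∃¬; injective⇒≤; cantor-schröder-bernstein; toℕ-fromℕ<
        ; punchIn-punchOut; punchOut-punchIn; punchOut-injective; punchIn-injective; punchInᵢ≢i; punchOut-cong)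
open import Data.Fin.Subset using (Subset; ⁅_⁆; ∣_∣) renaming (_∈_ to _∈ₛ_; _⊆_ to _⊆ₛ_; _⊂_ to _⊂ₛ_)
open import Data.Fin.Subset.Properties
  using (x∈⁅x⁆; x∈⁅y⁆⇒x≡y; ∣p∣≤n; p⊂q⇒∣p∣<∣q∣; ∣⁅x⁆∣≡1; ⊆⊤; ∈⊤; ∣⊤∣≡n) renaming (_∈?_ to _∈ₛ?_)
import Data.List.Base as List
open import Data.List.Extrema.Nat using (max; v≤max⁺)
open import Data.List.Membership.Propositional.Properties using (∈-map⁺; ∈-allFin)
import Data.List.Relation.Unary.Any as Any
open import Data.Nat.Base using (ℕ; zero; suc; _+_; _*_; _∸_; _≤_; _<_; s≤s)
open import Data.Nat.Induction using (<-rec)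
open import Data.Nat.Properties
  using ( _≤?_; _<?_; ≤-refl; ≤-reflexive; ≤-trans; <-trans; <-irrefl; <-asym; <-cmp; <⇒≤; <⇒≢; <⇒≱; ≰⇒>; ≮⇒≥
        ; ≤∧≢⇒<; <-≤-trans; ≤-<-trans; n≤1+n; n<1+n; m<n⇒m<1+n; m≤m+n; +-comm; *-suc; +-monoʳ-<
        ; +-cancelˡ-<; +-cancelˡ-≡; *-monoʳ-≤; ∸-monoʳ-≤; ∸-monoʳ-<; ∸-cancelˡ-≡; module ≤-Reasoning)
open import Data.Product using (∃; _×_; _,_; proj₁; proj₂)
open import Data.Sum using (_⊎_; inj₁; inj₂)
import Data.Sum as Sum
open import Data.Vec.Base using (tabulate)
open import Data.Vec.Properties using (lookup∘tabulate; lookup⇒[]=; []=⇒lookup)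
open import Function.Base using (_∘_)
open import Function.Bundles using (mk⇔; mk⤖)
open import Function.Construct.Identity using (↔-id)
open import Function.Properties.Bijection using (⤖⇒↔)
open import Level using (0ℓ)
open import Relation.Binary.Construct.Closure.ReflexiveTransitive as Star using (Star; ε; _◅_; _◅◅_)
open import Relation.Binary.Definitions using (tri<; tri≈; tri>)
open import Relation.Binary.PropositionalEquality as ≡ using (_≡_; _≢_; refl; trans; subst; subst₂; cong)
open import Relation.Nullary using (¬_; Dec; yes; no; does; contradiction)
open import Relation.Nullary.Decidable
  using (dec-true; dec-false; does-⇔; map′; _×-dec_; _⊎-dec_; _→-dec_; ¬?)
open import Relation.Unary using (Pred; _∈_; _⊆_; _∪_; _∖_; ｛_｝; U; Decidable)

private variable
  n m : ℕ

Adj-sym : (G : Graph n) {i j : Fin n} → Adj G i j → Adj G j i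
Adj-sym G {i} {j} e = trans (sym G j i) e

Adj-irrefl : (G : Graph n) {i : Fin n} → ¬ Adj G i i
Adj-irrefl G {i} e = contradiction (trans (≡.sym e) (irrefl G i)) λ ()

Adj⇒≢ : (G : Graph n) {i j : Fin n} → Adj G i j → i ≢ j
Adj⇒≢ G e refl = Adj-irrefl G e

Adj? : (G : Graph n) (i j : Fin n) → Dec (Adj G i j)
Adj? G i j = adj G i j Bool.≟ true

does-true⇒ : ∀ {A : Set} (a? : Dec A) → does a? ≡ true → A
does-true⇒ (yes a) _ = a

¬→⇒×¬ : ∀ {A B : Set} → Dec A → ¬ (A → B) → A × ¬ B
¬→⇒×¬ (yes a) ¬a→b = a , λ b → ¬a→b λ _ → b
¬→⇒×¬ (no ¬a) ¬a→b = ⊥-elim (¬a→b λ a → contradiction a ¬a)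

punchIn-onto : ∀ {b x : Fin (suc n)} → b ≢ x → ∃ λ x′ → punchIn b x′ ≡ x
punchIn-onto b≢x = punchOut b≢x , punchIn-punchOut b≢x

data Punched {n : ℕ} (w : Fin (suc n)) : Fin (suc n) → Set where
  pivot   : Punched w w
  punched : ∀ i → Punched w (punchIn w i)

punched? : ∀ {n} (w v : Fin (suc n)) → Punched w v
punched? w v with w ≟ v
... | yes refl = pivot
... | no w≢v   = subst (Punched w) (punchIn-punchOut w≢v) (punched (punchOut w≢v))

injective⇒surjective : ∀ {n} (f : Fin n → Fin n) → (∀ {x y} → f x ≡ f y → x ≡ y) → ∀ y → ∃ λ x → f x ≡ y
injective⇒surjective {suc n} f f-injective y with any? (λ x → f x ≟ y)
... | yes found = found
... | no ¬found =
  contradiction (injective⇒≤ (λ {x} {x′} → f-injective ∘ punchOut-injective (y≢f x) (y≢f x′))) (<-irrefl refl)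
  where
  y≢f : ∀ x → y ≢ f x
  y≢f x y≡fx = ¬found (x , ≡.sym y≡fx)

-- Decidable reachability in a finite graph

module _ {P : Fin n → Set} (P? : ∀ v → Dec (P v)) where
  subset : Subset n
  subset = tabulate (does ∘ P?)

  ∈-subset⁺ : ∀ {v} → P v → v ∈ₛ subset
  ∈-subset⁺ {v} Pv = lookup⇒[]= v _ (trans (lookup∘tabulate _ v) (dec-true (P? v) Pv))

  ∈-subset⁻ : ∀ {v} → v ∈ₛ subset → P v
  ∈-subset⁻ {v} v∈ = does-true⇒ (P? v) (trans (≡.sym (lookup∘tabulate _ v)) ([]=⇒lookup v∈))

module Reachability {n : ℕ} {R : Fin n → Fin n → Set} (R? : ∀ x y → Dec (R x y)) (x : Fin n) where

  Entered : Subset n → Fin n → Set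
  Entered S v = v ∈ₛ S ⊎ ∃ λ u → u ∈ₛ S × R u v

  entered? : ∀ S v → Dec (Entered S v)
  entered? S v = v ∈ₛ? S ⊎-dec any? λ u → u ∈ₛ? S ×-dec R? u v

  step : Subset n → Subset n
  step S = subset (entered? S)

  ∈-step⁺ : ∀ {S v} → Entered S v → v ∈ₛ step S
  ∈-step⁺ {S} = ∈-subset⁺ (entered? S)

  ∈-step⁻ : ∀ {S v} → v ∈ₛ step S → Entered S v
  ∈-step⁻ {S} = ∈-subset⁻ (entered? S)

  step-⊇ : ∀ {S} → S ⊆ₛ step S
  step-⊇ = ∈-step⁺ ∘ inj₁

  ClosedAt : Subset n → Fin n → Fin n → Set
  ClosedAt S u v = u ∈ₛ S → R u v → v ∈ₛ S

  closedAt? : ∀ S u v → Dec (ClosedAt S u v)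
  closedAt? S u v = u ∈ₛ? S →-dec R? u v →-dec v ∈ₛ? S

  Closed : Subset n → Set
  Closed S = ∀ u v → ClosedAt S u v

  closed-step : ∀ {S} → Closed S → Closed (step S)
  closed-step closed u v u∈ uRv with ∈-step⁻ u∈
  ... | inj₁ u∈S = step-⊇ (closed u v u∈S uRv)
  ... | inj₂ (t , t∈S , tRu) = step-⊇ (closed u v (closed t u t∈S tRu) uRv)

  closed-or-grows : ∀ S → Closed S ⊎ S ⊂ₛ step S
  closed-or-grows S with all? (λ u → all? (closedAt? S u))
  ... | yes closed = inj₁ closed
  ... | no ¬closed
    with u , ¬closed-u ← ¬∀⟶∃¬ n _ (λ u → all? (closedAt? S u)) ¬closed
    with v , ¬closed-uv ← ¬∀⟶∃¬ n _ (closedAt? S u) ¬closed-u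
    with u∈S , ¬[uRv→v∈S] ← ¬→⇒×¬ (u ∈ₛ? S) ¬closed-uv
    with uRv , v∉S ← ¬→⇒×¬ (R? u v) ¬[uRv→v∈S]
    = inj₂ (step-⊇ , v , ∈-step⁺ (inj₂ (u , u∈S , uRv)) , v∉S)

  within : ℕ → Subset n
  within zero    = ⁅ x ⁆
  within (suc k) = step (within k)

  within-sound : ∀ k {v} → v ∈ₛ within k → Star R x v
  within-sound zero    v∈ with refl ← x∈⁅y⁆⇒x≡y x v∈ = ε
  within-sound (suc k) v∈ with ∈-step⁻ v∈
  ... | inj₁ v∈′ = within-sound k v∈′
  ... | inj₂ (u , u∈ , uRv) = within-sound k u∈ ◅◅ (uRv ◅ ε)

  closed-or-large : ∀ k → Closed (within k) ⊎ k < ∣ within k ∣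
  closed-or-large zero with closed-or-grows ⁅ x ⁆
  ... | inj₁ closed = inj₁ closed
  ... | inj₂ _      = inj₂ (≤-reflexive (≡.sym (∣⁅x⁆∣≡1 x)))
  closed-or-large (suc k) with closed-or-large k
  ... | inj₁ closed = inj₁ (closed-step closed)
  ... | inj₂ large with closed-or-grows (within k)
  ...   | inj₁ closed = inj₁ (closed-step closed)
  ...   | inj₂ grows  = inj₂ (≤-<-trans large (p⊂q⇒∣p∣<∣q∣ grows))

  within-closed : Closed (within n)
  within-closed with closed-or-large n
  ... | inj₁ closed = closed
  ... | inj₂ large  = contradiction (∣p∣≤n (within n)) (<⇒≱ large)

  x∈within : ∀ k → x ∈ₛ within k
  x∈within zero    = x∈⁅x⁆ x
  x∈within (suc k) = step-⊇ (x∈within k)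

  within-complete : ∀ {u v} → u ∈ₛ within n → Star R u v → v ∈ₛ within n
  within-complete u∈ ε           = u∈
  within-complete u∈ (uRt ◅ tRv) = within-complete (within-closed _ _ u∈ uRt) tRv

  reachable? : ∀ y → Dec (Star R x y)
  reachable? y = map′ (within-sound n) (within-complete (x∈within n)) (y ∈ₛ? within n)

star? : ∀ {n} {R : Fin n → Fin n → Set} → (∀ x y → Dec (R x y)) → ∀ x y → Dec (Star R x y)
star? R? = Reachability.reachable? R?

HasK4Minor-◅ : {G : Graph n} {H : Graph m} → MinorStep (n , G) (m , H) → HasK4Minor H → HasK4Minor G
HasK4Minor-◅ st (K , steps , iso) = K , st ◅ steps , iso

K4MinorFree-◅ : {G : Graph n} {H : Graph m} → MinorStep (n , G) (m , H) → K4MinorFree G → K4MinorFree H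
K4MinorFree-◅ st free = free ∘ HasK4Minor-◅ st

module Contract {m : ℕ} (G : Graph (suc m)) (v : Fin (suc m)) (u : Fin m) where

  MergedAdj : Fin m → Fin m → Set
  MergedAdj i j = Adj G (punchIn v i) (punchIn v j)
                ⊎ ((i ≡ u × Adj G v (punchIn v j)) ⊎ (j ≡ u × Adj G (punchIn v i) v))

  MergedAdj-sym : ∀ {i j} → MergedAdj i j → MergedAdj j i
  MergedAdj-sym (inj₁ e)               = inj₁ (Adj-sym G e)
  MergedAdj-sym (inj₂ (inj₁ (i≡u , e))) = inj₂ (inj₂ (i≡u , Adj-sym G e))
  MergedAdj-sym (inj₂ (inj₂ (j≡u , e))) = inj₂ (inj₁ (j≡u , Adj-sym G e))

  mergedAdj? : ∀ i j → Dec (i ≢ j × MergedAdj i j)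
  mergedAdj? i j = ¬? (i ≟ j) ×-dec (Adj? G _ _ ⊎-dec ((i ≟ u ×-dec Adj? G _ _) ⊎-dec (j ≟ u ×-dec Adj? G _ _)))

  merged : Graph m
  merged = record
    { adj    = λ i j → does (mergedAdj? i j)
    ; sym    = λ i j → does-⇔ (mk⇔ flip flip) (mergedAdj? i j) (mergedAdj? j i)
    ; irrefl = λ i → dec-false (mergedAdj? i i) λ (i≢i , _) → i≢i refl
    }
    where
    flip : ∀ {i j} → i ≢ j × MergedAdj i j → j ≢ i × MergedAdj j i
    flip (i≢j , e) = i≢j ∘ ≡.sym , MergedAdj-sym e

  merged-Adj⁻ : ∀ {i j} → Adj merged i j → MergedAdj i j
  merged-Adj⁻ {i} {j} e = proj₂ (does-true⇒ (mergedAdj? i j) e)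

  merged-Adj⁺ : ∀ {i j} → i ≢ j → MergedAdj i j → Adj merged i j
  merged-Adj⁺ {i} {j} i≢j e = dec-true (mergedAdj? i j) (i≢j , e)

  isContraction : Adj G v (punchIn v u) → Contraction G merged
  isContraction vu = v , u , vu , λ i j i≢j → merged-Adj⁻ , merged-Adj⁺ i≢j

Iso-complete : (G : Graph n) → (∀ {i j} → i ≢ j → Adj G i j) → Iso G (complete n)
Iso-complete G full = ↔-id _ , completeAdj≡adj
  where
  completeAdj≡adj : ∀ i j → adj (complete _) i j ≡ adj G i j
  completeAdj≡adj i j with i ≟ j
  ... | yes refl = ≡.sym (irrefl G i)
  ... | no i≢j   = ≡.sym (full i≢j)

Clique4 : Graph n → (Fin 4 → Fin n) → Set
Clique4 G f = ∀ {i j} → i ≢ j → Adj G (f i) (f j)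

Clique4-injective : (G : Graph n) {f : Fin 4 → Fin n} → Clique4 G f → ∀ {i j} → f i ≡ f j → i ≡ j
Clique4-injective G clique {i} {j} fi≡fj with i ≟ j
... | yes i≡j = i≡j
... | no i≢j  = contradiction fi≡fj (Adj⇒≢ G (clique i≢j))

Clique4-onto-K4 : ∀ {k} → 4 ≡ k → (G : Graph k) (f : Fin 4 → Fin k) → Clique4 G f →
                  (∀ y → ∃ λ i → f i ≡ y) → HasK4Minor G
Clique4-onto-K4 refl G f clique onto = G , ε , Iso-complete G full
  where
  full : ∀ {y z} → y ≢ z → Adj G y z
  full {y} {z} y≢z with i , refl ← onto y | j , refl ← onto z = clique (y≢z ∘ cong f)

Clique4-K4 : (G : Graph n) (f : Fin 4 → Fin n) → Clique4 G f → HasK4Minor G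
Clique4-K4 {zero} G f _ = contradiction (f zero) λ ()
Clique4-K4 {suc n} G f clique with any? (λ y → ¬? (any? λ i → f i ≟ y))
... | yes (y , y∉f) = HasK4Minor-◅ (delVertex G y) (Clique4-K4 (deleteVertex G y) f′ clique′)
  where
  y≢f : ∀ i → y ≢ f i
  y≢f i y≡fi = y∉f (i , ≡.sym y≡fi)
  f′ : Fin 4 → Fin n
  f′ i = punchOut (y≢f i)
  clique′ : Clique4 (deleteVertex G y) f′
  clique′ i≢j = subst₂ (Adj G) (≡.sym (punchIn-punchOut (y≢f _))) (≡.sym (punchIn-punchOut (y≢f _))) (clique i≢j)
... | no ¬y∉f = Clique4-onto-K4 (cantor-schröder-bernstein (Clique4-injective G clique) preimage-injective)
                   G f clique preimage
  where
  preimage : ∀ y → ∃ λ i → f i ≡ y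
  preimage y with any? (λ i → f i ≟ y)
  ... | yes p  = p
  ... | no y∉f = contradiction (y , y∉f) ¬y∉f
  preimage-injective : ∀ {y z} → proj₁ (preimage y) ≡ proj₁ (preimage z) → y ≡ z
  preimage-injective {y} {z} e =
    trans (≡.sym (proj₂ (preimage y))) (trans (cong f e) (proj₂ (preimage z)))

-- Minimum degree three forces a K4 minor

Distinct3 : {A : Set} → A → A → A → Set
Distinct3 p q r = p ≢ q × p ≢ r × q ≢ r

Two Three Four : {A : Set} → Pred A 0ℓ → Set
Two   P = ∃ λ p → ∃ λ q → p ≢ q × P p × P q
Three P = ∃ λ p → ∃ λ q → ∃ λ r → Distinct3 p q r × P p × P q × P r
Four  P = ∃ λ p → ∃ λ q → ∃ λ r → ∃ λ s →
          (p ≢ q × p ≢ r × p ≢ s) × Distinct3 q r s × P p × P q × P r × P s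

Among3 : {A : Set} → A → A → A → Pred A 0ℓ
Among3 a b c t = t ≡ a ⊎ t ≡ b ⊎ t ≡ c

module _ {A : Set} {a b c t : A} where

  Among3-swap₁₂ : Among3 a b c t → Among3 b a c t
  Among3-swap₁₂ (inj₁ t≡a)        = inj₂ (inj₁ t≡a)
  Among3-swap₁₂ (inj₂ (inj₁ t≡b)) = inj₁ t≡b
  Among3-swap₁₂ (inj₂ (inj₂ t≡c)) = inj₂ (inj₂ t≡c)

  Among3-swap₂₃ : Among3 a b c t → Among3 a c b t
  Among3-swap₂₃ (inj₁ t≡a)        = inj₁ t≡a
  Among3-swap₂₃ (inj₂ (inj₁ t≡b)) = inj₂ (inj₂ t≡b)
  Among3-swap₂₃ (inj₂ (inj₂ t≡c)) = inj₂ (inj₁ t≡c)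

  Among3-reverse : Among3 a b c t → Among3 c b a t
  Among3-reverse (inj₁ t≡a)        = inj₂ (inj₂ t≡a)
  Among3-reverse (inj₂ (inj₁ t≡b)) = inj₂ (inj₁ t≡b)
  Among3-reverse (inj₂ (inj₂ t≡c)) = inj₁ t≡c

module _ {P : Pred (Fin n) 0ℓ} where

  Three? : Decidable P → Dec (Three P)
  Three? P? = any? λ p → any? λ q → any? λ r →
    (¬? (p ≟ q) ×-dec ¬? (p ≟ r) ×-dec ¬? (q ≟ r)) ×-dec P? p ×-dec P? q ×-dec P? r

  Four? : Decidable P → Dec (Four P)
  Four? P? = any? λ p → any? λ q → any? λ r → any? λ s →
    (¬? (p ≟ q) ×-dec ¬? (p ≟ r) ×-dec ¬? (p ≟ s)) ×-dec (¬? (q ≟ r) ×-dec ¬? (q ≟ s) ×-dec ¬? (r ≟ s))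
    ×-dec P? p ×-dec P? q ×-dec P? r ×-dec P? s

  Four-minus : Four P → ∀ z → Three (P ∖ ｛ z ｝)
  Four-minus (p , q , r , s , (p≢q , p≢r , p≢s) , (q≢r , q≢s , r≢s) , Pp , Pq , Pr , Ps) z
    with z ≟ p | z ≟ q | z ≟ r | z ≟ s
  ... | yes refl | _ | _ | _ =
    q , r , s , (q≢r , q≢s , r≢s) , (Pq , p≢q) , (Pr , p≢r) , (Ps , p≢s)
  ... | no z≢p | yes refl | _ | _ =
    p , r , s , (p≢r , p≢s , r≢s) , (Pp , z≢p) , (Pr , q≢r) , (Ps , q≢s)
  ... | no z≢p | no z≢q | yes refl | _ =
    p , q , s , (p≢q , p≢s , q≢s) , (Pp , z≢p) , (Pq , z≢q) , (Ps , r≢s)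
  ... | no z≢p | no z≢q | no z≢r | _ =
    p , q , r , (p≢q , p≢r , q≢r) , (Pp , z≢p) , (Pq , z≢q) , (Pr , z≢r)

  Three-minus : Three P → ∀ z → Two (P ∖ ｛ z ｝)
  Three-minus (p , q , r , (p≢q , p≢r , q≢r) , Pp , Pq , Pr) z with z ≟ p | z ≟ q
  ... | yes refl | _      = q , r , q≢r , (Pq , p≢q) , (Pr , p≢r)
  ... | no z≢p | yes refl = p , r , p≢r , (Pp , z≢p) , (Pr , q≢r)
  ... | no z≢p | no z≢q   = p , q , p≢q , (Pp , z≢p) , (Pq , z≢q)

  Two-minus : Two P → ∀ z → ∃ (P ∖ ｛ z ｝)
  Two-minus (p , q , p≢q , Pp , Pq) z with z ≟ p
  ... | yes refl = q , Pq , p≢q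
  ... | no z≢p   = p , Pp , z≢p

  Three-among : ¬ Four P → ∀ {a b c} → Distinct3 a b c → P a → P b → P c →
                ∀ {t} → P t → Among3 a b c t
  Three-among ¬four {a} {b} {c} abc Pa Pb Pc {t} Pt with t ≟ a | t ≟ b | t ≟ c
  ... | yes t≡a | _ | _ = inj₁ t≡a
  ... | no _ | yes t≡b | _ = inj₂ (inj₁ t≡b)
  ... | no _ | no _ | yes t≡c = inj₂ (inj₂ t≡c)
  ... | no t≢a | no t≢b | no t≢c = ⊥-elim (¬four (t , a , b , c , (t≢a , t≢b , t≢c) , abc , Pt , Pa , Pb , Pc))

¬Three⇒AtMostTwo : {P : Pred (Fin n) 0ℓ} → Decidable P → ¬ Three P →
                   (∀ {x y} → P x → P y → x ≡ y) ⊎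
                   (∃ λ a → ∃ λ b → a ≢ b × P a × P b × ∀ {x} → P x → x ≡ a ⊎ x ≡ b)
¬Three⇒AtMostTwo {P = P} P? ¬three with any? P?
... | no none = inj₁ λ Px _ → contradiction (_ , Px) none
... | yes (a , Pa) with any? (λ x → P? x ×-dec ¬? (x ≟ a))
...   | no only-a = inj₁ λ Px Py → trans (is-a Px) (≡.sym (is-a Py))
  where
  is-a : ∀ {x} → P x → x ≡ a
  is-a {x} Px with x ≟ a
  ... | yes x≡a = x≡a
  ... | no x≢a  = contradiction (x , Px , x≢a) only-a
...   | yes (b , Pb , b≢a) = inj₂ (a , b , b≢a ∘ ≡.sym , Pa , Pb , among)
  where
  among : ∀ {x} → P x → x ≡ a ⊎ x ≡ b
  among {x} Px with x ≟ a | x ≟ b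
  ... | yes x≡a | _       = inj₁ x≡a
  ... | no _    | yes x≡b = inj₂ x≡b
  ... | no x≢a  | no x≢b  = ⊥-elim (¬three (a , b , x , (b≢a ∘ ≡.sym , x≢a ∘ ≡.sym , x≢b ∘ ≡.sym) , Pa , Pb , Px))

Three-map : {A B : Set} {P : Pred A 0ℓ} {Q : Pred B 0ℓ} (h : ∀ {a} → P a → B) →
            (∀ {a b} (Pa : P a) (Pb : P b) → a ≢ b → h Pa ≢ h Pb) →
            (∀ {a} (Pa : P a) → Q (h Pa)) → Three P → Three Q
Three-map h h-≢ h-Q (p , q , r , (p≢q , p≢r , q≢r) , Pp , Pq , Pr) =
  h Pp , h Pq , h Pr , (h-≢ Pp Pq p≢q , h-≢ Pp Pr p≢r , h-≢ Pq Pr q≢r) , h-Q Pp , h-Q Pq , h-Q Pr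

Three-⊆ : {A : Set} {P Q : Pred A 0ℓ} → (∀ {a} → P a → Q a) → Three P → Three Q
Three-⊆ P⊆Q = Three-map (λ {a} _ → a) (λ _ _ a≢b → a≢b) P⊆Q

Three-∖ : {A : Set} {P : Pred A 0ℓ} {w : A} → (∀ {t} → P t → w ≢ t) → Three P → Three (P ∖ ｛ w ｝)
Three-∖ w≢ = Three-⊆ λ Pt → Pt , w≢ Pt

Three-punchOut : ∀ {b : Fin (suc n)} {P : Pred (Fin (suc n)) 0ℓ} → Three (P ∖ ｛ b ｝) → Three (P ∘ punchIn b)
Three-punchOut {P = P} = Three-map (λ (_ , b≢t) → punchOut b≢t)
  (λ (_ , b≢s) (_ , b≢t) s≢t e → s≢t (punchOut-injective b≢s b≢t e))
  (λ (Pt , b≢t) → subst P (≡.sym (punchIn-punchOut b≢t)) Pt)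

Degree≥3 Degree≥4 : Graph n → Fin n → Set
Degree≥3 G v = Three (Adj G v)
Degree≥4 G v = Four (Adj G v)

MinDegree3 : Graph n → Set
MinDegree3 G = ∀ v → Degree≥3 G v

Degree≥3-avoiding : (G : Graph n) {z w : Fin n} → ¬ Adj G z w → Degree≥3 G z → Three (Adj G z ∖ ｛ w ｝)
Degree≥3-avoiding G ¬zw = Three-∖ λ zt → λ { refl → ¬zw zt }

MinDegree3-deleted : (G : Graph (suc n)) (b : Fin (suc n)) →
                     (∀ z → b ≢ z → Three (Adj G z ∖ ｛ b ｝)) → MinDegree3 (deleteVertex G b)
MinDegree3-deleted G b deg z′ = Three-punchOut (deg (punchIn b z′) (punchInᵢ≢i b z′ ∘ ≡.sym))

Three-deleted : (G : Graph (suc n)) {b : Fin (suc n)} {z′ w′ : Fin n} →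
                Three ((Adj G (punchIn b z′) ∖ ｛ punchIn b w′ ｝) ∖ ｛ b ｝) →
                Three (Adj (deleteVertex G b) z′ ∖ ｛ w′ ｝)
Three-deleted G {b} = Three-⊆ (λ (e , w≢t) → e , w≢t ∘ cong (punchIn b)) ∘ Three-punchOut

K4Below : ℕ → Set
K4Below n = ∀ {k} → k < n → (G : Graph k) → Fin k → MinDegree3 G → HasK4Minor G

module ContractEdge {m : ℕ} (G : Graph (suc m)) {x y : Fin (suc m)} (xy : Adj G x y) where

  x≢y : x ≢ y
  x≢y = Adj⇒≢ G xy

  y′ : Fin m
  y′ = punchOut x≢y

  open Contract G x y′ public using (merged; merged-Adj⁺; isContraction)

  image : Fin (suc m) → Fin m
  image p with x ≟ p
  ... | yes _   = y′
  ... | no x≢p = punchOut x≢p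

  image-x : image x ≡ y′
  image-x with x ≟ x
  ... | yes _   = refl
  ... | no x≢x = contradiction refl x≢x

  image-punchOut : ∀ {p} (x≢p : x ≢ p) → image p ≡ punchOut x≢p
  image-punchOut {p} x≢p with x ≟ p
  ... | yes x≡p = contradiction x≡p x≢p
  ... | no _    = punchOut-cong x refl

  image-punchIn : ∀ z′ → image (punchIn x z′) ≡ z′
  image-punchIn z′ = trans (image-punchOut _) (punchOut-punchIn x)

  image-Adj : ∀ {p q} → Adj G p q → image p ≢ image q → Adj merged (image p) (image q)
  image-Adj {p} {q} e ip≢iq with x ≟ p | x ≟ q
  ... | yes refl | yes refl = contradiction e (Adj-irrefl G)
  ... | yes refl | no x≢q =
    merged-Adj⁺ ip≢iq (inj₂ (inj₁ (refl , subst (Adj G x) (≡.sym (punchIn-punchOut x≢q)) e)))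
  ... | no x≢p | yes refl =
    merged-Adj⁺ ip≢iq (inj₂ (inj₂ (refl , subst (λ t → Adj G t x) (≡.sym (punchIn-punchOut x≢p)) e)))
  ... | no x≢p | no x≢q =
    merged-Adj⁺ ip≢iq (inj₁ (subst₂ (Adj G) (≡.sym (punchIn-punchOut x≢p)) (≡.sym (punchIn-punchOut x≢q)) e))

  image-≢ : ∀ {p q} → p ≢ q → (x ≢ p × x ≢ q) ⊎ (y ≢ p × y ≢ q) → image p ≢ image q
  image-≢ {p} {q} p≢q avoid ip≡iq with x ≟ p | x ≟ q | avoid
  ... | yes refl | yes refl | _ = p≢q refl
  ... | yes refl | no _ | inj₁ (x≢p , _) = x≢p refl
  ... | yes refl | no x≢q | inj₂ (_ , y≢q) = y≢q (punchOut-injective x≢y x≢q ip≡iq)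
  ... | no _ | yes refl | inj₁ (_ , x≢q) = x≢q refl
  ... | no x≢p | yes refl | inj₂ (y≢p , _) = y≢p (punchOut-injective x≢y x≢p (≡.sym ip≡iq))
  ... | no x≢p | no x≢q | _ = p≢q (punchOut-injective x≢p x≢q ip≡iq)

  image-≢-avoiding : ∀ {w} → w ≡ x ⊎ w ≡ y → ∀ {s t} → s ≢ t → w ≢ s → w ≢ t → image s ≢ image t
  image-≢-avoiding (inj₁ refl) s≢t x≢s x≢t = image-≢ s≢t (inj₁ (x≢s , x≢t))
  image-≢-avoiding (inj₂ refl) s≢t y≢s y≢t = image-≢ s≢t (inj₂ (y≢s , y≢t))

  Degree≥3-image : ∀ {w} → w ≡ x ⊎ w ≡ y → ∀ z′ → w ≢ punchIn x z′ →
                   Three (Adj G (punchIn x z′) ∖ ｛ w ｝) → Degree≥3 merged z′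
  Degree≥3-image w∈xy z′ w≢z = Three-map (λ {t} _ → image t)
    (λ (_ , w≢s) (_ , w≢t) s≢t → image-≢-avoiding w∈xy s≢t w≢s w≢t)
    (λ {t} (zt , w≢t) → subst (λ z → Adj merged z (image t)) (image-punchIn z′)
                      (image-Adj zt (image-≢-avoiding w∈xy (Adj⇒≢ G zt) w≢z w≢t)))

  MergedNeighbour : Pred (Fin (suc m)) 0ℓ
  MergedNeighbour s = (x ≢ s × y ≢ s) × (Adj G x s ⊎ Adj G y s)

  Degree≥3-merged : Three MergedNeighbour → Degree≥3 merged y′
  Degree≥3-merged = Three-map (λ {s} _ → image s)
    (λ ((x≢s , _) , _) ((x≢t , _) , _) s≢t → image-≢ s≢t (inj₁ (x≢s , x≢t))) adjacent
    where
    adjacent : ∀ {s} → MergedNeighbour s → Adj merged y′ (image s)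
    adjacent {s} ((x≢s , y≢s) , inj₁ xs) =
      subst (λ t → Adj merged t (image s)) image-x (image-Adj xs (image-≢ x≢s (inj₂ (x≢y ∘ ≡.sym , y≢s))))
    adjacent {s} ((x≢s , y≢s) , inj₂ ys) =
      subst (λ t → Adj merged t (image s)) (image-punchOut x≢y) (image-Adj ys (image-≢ y≢s (inj₁ (x≢y , x≢s))))

  KeepsNeighbours : Pred (Fin (suc m)) 0ℓ
  KeepsNeighbours z = Three (Adj G z ∖ ｛ x ｝) ⊎ Three (Adj G z ∖ ｛ y ｝)

  MinDegree3-merged : Three MergedNeighbour → (∀ z → x ≢ z → y ≢ z → KeepsNeighbours z) → MinDegree3 merged
  MinDegree3-merged three keeps z′ with y ≟ punchIn x z′
  ... | yes y≡z = subst (Degree≥3 merged) y′≡z′ (Degree≥3-merged three)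
    where
    y′≡z′ : y′ ≡ z′
    y′≡z′ = trans (≡.sym (image-punchOut x≢y)) (trans (cong image y≡z) (image-punchIn z′))
  ... | no y≢z with keeps (punchIn x z′) (punchInᵢ≢i x z′ ∘ ≡.sym) y≢z
  ...   | inj₁ avoid-x = Degree≥3-image (inj₁ refl) z′ (punchInᵢ≢i x z′ ∘ ≡.sym) avoid-x
  ...   | inj₂ avoid-y = Degree≥3-image (inj₂ refl) z′ y≢z avoid-y

  K4-by-contraction : K4Below (suc m) → Three MergedNeighbour → (∀ z → x ≢ z → y ≢ z → KeepsNeighbours z) →
                      HasK4Minor G
  K4-by-contraction IH three keeps =
    HasK4Minor-◅ (contract G merged (isContraction (subst (Adj G x) (≡.sym (punchIn-punchOut x≢y)) xy)))
      (IH (n<1+n m) merged y′ (MinDegree3-merged three keeps))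

K4-all-Degree≥4 : K4Below (suc n) → (G : Graph (suc n)) → (∀ v → Degree≥4 G v) → HasK4Minor G
K4-all-Degree≥4 {n} IH G deg4 with _ , _ , _ , _ , _ , _ , zp , _ ← deg4 zero =
  HasK4Minor-◅ (delVertex G zero)
    (IH (n<1+n n) (deleteVertex G zero) (punchOut (Adj⇒≢ G zp))
        (MinDegree3-deleted G zero λ z _ → Four-minus (deg4 z) zero))

CommonNeighbour : Graph n → Fin n → Fin n → Set
CommonNeighbour G x y = ∃ λ t → Adj G x t × Adj G y t

commonNeighbour? : (G : Graph n) → ∀ x y → Dec (CommonNeighbour G x y)
commonNeighbour? G x y = any? λ t → Adj? G x t ×-dec Adj? G y t

K4-no-common-neighbour : K4Below (suc n) → (G : Graph (suc n)) → MinDegree3 G →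
                         ∀ {x y} → Adj G x y → ¬ CommonNeighbour G x y → HasK4Minor G
K4-no-common-neighbour IH G δ {x} {y} xy ¬common
  with s₁ , s₂ , s₁≢s₂ , (xs₁ , y≢s₁) , (xs₂ , y≢s₂) ← Three-minus (δ x) y
     | s₃ , _ , _ , (ys₃ , x≢s₃) , _ ← Three-minus (δ y) x
  = ContractEdge.K4-by-contraction G xy IH merged keeps
  where
  merged : Three (ContractEdge.MergedNeighbour G xy)
  merged = s₁ , s₂ , s₃
         , (s₁≢s₂ , (λ { refl → ¬common (s₁ , xs₁ , ys₃) }) , λ { refl → ¬common (s₂ , xs₂ , ys₃) })
         , ((Adj⇒≢ G xs₁ , y≢s₁) , inj₁ xs₁) , ((Adj⇒≢ G xs₂ , y≢s₂) , inj₁ xs₂)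
         , ((x≢s₃ , Adj⇒≢ G ys₃) , inj₂ ys₃)
  keeps : ∀ z → x ≢ z → y ≢ z → ContractEdge.KeepsNeighbours G xy z
  keeps z _ _ with Adj? G z x
  ... | no ¬zx = inj₁ (Degree≥3-avoiding G ¬zx (δ z))
  ... | yes zx = inj₂ (Degree≥3-avoiding G (λ zy → ¬common (z , Adj-sym G zx , Adj-sym G zy)) (δ z))

Triangulated : Graph n → Set
Triangulated G = ∀ {x y} → Adj G x y → CommonNeighbour G x y

NeighbourhoodIn : Graph n → Fin n → Fin n → Fin n → Fin n → Set
NeighbourhoodIn G x a b c = ∀ {t} → Adj G x t → Among3 a b c t

only-partner : (G : Graph n) → Triangulated G → ∀ {x p q r} → NeighbourhoodIn G x p q r →
               Adj G x p → ¬ Adj G p r → Adj G p q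
only-partner G tri N[x] xp ¬pr with t , xt , pt ← tri xp | N[x] xt
... | inj₁ refl        = contradiction pt (Adj-irrefl G)
... | inj₂ (inj₁ refl) = pt
... | inj₂ (inj₂ refl) = contradiction pt ¬pr

Degree≥4-path-end : (G : Graph n) → Triangulated G → MinDegree3 G → ∀ {x a b c} →
                    NeighbourhoodIn G x a b c → NeighbourhoodIn G b x a c →
                    Adj G x a → Adj G a b → x ≢ b → ¬ Adj G a c → Degree≥4 G a
Degree≥4-path-end G tri δ {x} {a} {b} {c} N[x] N[b] xa ab x≢b ¬ac with Four? (Adj? G a)
... | yes deg4 = deg4
... | no ¬deg4
  with p , ((ap , x≢p) , b≢p) ← Two-minus (Three-minus (δ a) x) b
  with t , at , pt ← tri ap
  = ⊥-elim (no-triangle ap x≢p b≢p (Three-among ¬deg4 (x≢b , x≢p , b≢p) (Adj-sym G xa) ab ap at) pt)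
  where
  no-triangle : ∀ {p t} → Adj G a p → x ≢ p → b ≢ p → Among3 x b p t → ¬ Adj G p t
  no-triangle ap x≢p b≢p (inj₁ refl) px with N[x] (Adj-sym G px)
  ... | inj₁ refl        = Adj-irrefl G ap
  ... | inj₂ (inj₁ refl) = b≢p refl
  ... | inj₂ (inj₂ refl) = ¬ac ap
  no-triangle ap x≢p b≢p (inj₂ (inj₁ refl)) pb with N[b] (Adj-sym G pb)
  ... | inj₁ refl        = x≢p refl
  ... | inj₂ (inj₁ refl) = Adj-irrefl G ap
  ... | inj₂ (inj₂ refl) = ¬ac ap
  no-triangle _ _ _ (inj₂ (inj₂ refl)) pp = Adj-irrefl G pp

K4-path-middle-Degree≥4 : K4Below (suc n) → (G : Graph (suc n)) → MinDegree3 G → ∀ {x a b c} →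
                          NeighbourhoodIn G x a b c → Distinct3 a b c → Adj G x a → Adj G x b → Adj G x c →
                          ¬ Adj G a c → Degree≥4 G b → HasK4Minor G
K4-path-middle-Degree≥4 IH G δ {x} {a} {b} {c} N[x] (a≢b , a≢c , b≢c) xa xb xc ¬ac deg4b
  with s , ((as , x≢s) , b≢s) ← Two-minus (Three-minus (δ a) x) b
  = ContractEdge.K4-by-contraction G xa IH merged keeps
  where
  merged : Three (ContractEdge.MergedNeighbour G xa)
  merged = b , c , s , (b≢c , b≢s , λ { refl → ¬ac as })
         , ((Adj⇒≢ G xb , a≢b) , inj₁ xb) , ((Adj⇒≢ G xc , a≢c) , inj₁ xc) , ((x≢s , Adj⇒≢ G as) , inj₂ as)
  keeps : ∀ z → x ≢ z → a ≢ z → ContractEdge.KeepsNeighbours G xa z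
  keeps z x≢z a≢z with b ≟ z | Adj? G z x
  ... | yes refl | _ = inj₁ (Four-minus deg4b x)
  ... | no _ | no ¬zx = inj₁ (Degree≥3-avoiding G ¬zx (δ z))
  ... | no b≢z | yes zx with N[x] (Adj-sym G zx)
  ...   | inj₁ refl        = contradiction refl a≢z
  ...   | inj₂ (inj₁ refl) = contradiction refl b≢z
  ...   | inj₂ (inj₂ refl) = inj₂ (Degree≥3-avoiding G (¬ac ∘ Adj-sym G) (δ c))

K4-path-middle-Degree3 : K4Below (suc (suc n)) → (G : Graph (suc (suc n))) → MinDegree3 G → ∀ {x a b c} →
                         NeighbourhoodIn G x a b c → NeighbourhoodIn G b x a c → Distinct3 a b c →
                         Adj G x a → Adj G x b → Adj G x c → ¬ Adj G a c → Degree≥4 G a → Degree≥4 G c →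
                         HasK4Minor G
K4-path-middle-Degree3 {n} IH G δ {x} {a} {b} {c} N[x] N[b] (a≢b , a≢c , b≢c) xa xb xc ¬ac deg4a deg4c
  with x′ , refl ← punchIn-onto (Adj⇒≢ G xb ∘ ≡.sym)
     | a′ , refl ← punchIn-onto (a≢b ∘ ≡.sym)
     | c′ , refl ← punchIn-onto b≢c
  with p , q , p≢q , ((ap , b≢p) , x≢p) , ((aq , b≢q) , x≢q) ← Three-minus (Four-minus deg4a b) x
  = HasK4Minor-◅ (delVertex G b) (ContractEdge.K4-by-contraction G-b xa IH′ merged keeps)
  where
  G-b = deleteVertex G b
  π = punchIn b
  IH′ : K4Below (suc n)
  IH′ k<1+n = IH (m<n⇒m<1+n k<1+n)
  merged : Three (ContractEdge.MergedNeighbour G-b xa)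
  merged = Three-⊆ (λ ((x≢s , a≢s) , e) → (x≢s ∘ cong π , a≢s ∘ cong π) , e)
    (Three-punchOut {P = ContractEdge.MergedNeighbour G xa}
    (c , p , q , ((λ { refl → ¬ac ap }) , (λ { refl → ¬ac aq }) , p≢q)
    , (((Adj⇒≢ G xc , a≢c) , inj₁ xc) , b≢c)
    , (((x≢p , Adj⇒≢ G ap) , inj₂ ap) , b≢p)
    , (((x≢q , Adj⇒≢ G aq) , inj₂ aq) , b≢q)))
  keeps : ∀ z′ → x′ ≢ z′ → a′ ≢ z′ → ContractEdge.KeepsNeighbours G-b xa z′
  keeps z′ x′≢z′ a′≢z′ with c′ ≟ z′
  ... | yes refl = inj₂ (Three-deleted G (Three-⊆ (λ (ct , b≢t) → (ct , λ { refl → ¬ac (Adj-sym G ct) }) , b≢t)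
                                                   (Four-minus deg4c b)))
  ... | no c′≢z′ = inj₁ (Three-deleted G (Three-∖ (λ (zt , _) → λ { refl → ¬zb zt })
                                           (Degree≥3-avoiding G ¬zx (δ (π z′)))))
    where
    ¬zx : ¬ Adj G (π z′) x
    ¬zx zx with N[x] (Adj-sym G zx)
    ... | inj₁ a≡z = a′≢z′ (punchIn-injective b a′ z′ (≡.sym a≡z))
    ... | inj₂ (inj₁ b≡z) = punchInᵢ≢i b z′ b≡z
    ... | inj₂ (inj₂ c≡z) = c′≢z′ (punchIn-injective b c′ z′ (≡.sym c≡z))
    ¬zb : ¬ Adj G (π z′) b
    ¬zb zb with N[b] (Adj-sym G zb)
    ... | inj₁ x≡z = x′≢z′ (punchIn-injective b x′ z′ (≡.sym x≡z))
    ... | inj₂ (inj₁ a≡z) = a′≢z′ (punchIn-injective b a′ z′ (≡.sym a≡z))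
    ... | inj₂ (inj₂ c≡z) = c′≢z′ (punchIn-injective b c′ z′ (≡.sym c≡z))

K4-path : K4Below (suc (suc n)) → (G : Graph (suc (suc n))) → MinDegree3 G → Triangulated G →
          ∀ {x a b c} → NeighbourhoodIn G x a b c → Distinct3 a b c → Adj G x a → Adj G x b → Adj G x c →
          Adj G a b → Adj G b c → ¬ Adj G a c → HasK4Minor G
K4-path IH G δ tri {x} {a} {b} {c} N[x] abc@(a≢b , a≢c , b≢c) xa xb xc ab bc ¬ac with Four? (Adj? G b)
... | yes deg4b = K4-path-middle-Degree≥4 IH G δ N[x] abc xa xb xc ¬ac deg4b
... | no ¬deg4b = K4-path-middle-Degree3 IH G δ N[x] N[b] abc xa xb xc ¬ac
    (Degree≥4-path-end G tri δ N[x] N[b] xa ab (Adj⇒≢ G xb) ¬ac)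
    (Degree≥4-path-end G tri δ (Among3-reverse ∘ N[x]) (Among3-swap₂₃ ∘ N[b])
       xc (Adj-sym G bc) (Adj⇒≢ G xb) (¬ac ∘ Adj-sym G))
  where
  N[b] : NeighbourhoodIn G b x a c
  N[b] = Three-among ¬deg4b (Adj⇒≢ G xa , Adj⇒≢ G xc , a≢c) (Adj-sym G xb) (Adj-sym G ab) bc

K4-clique : (G : Graph n) {x a b c : Fin n} → Adj G x a → Adj G x b → Adj G x c →
            Adj G a b → Adj G a c → Adj G b c → HasK4Minor G
K4-clique {n} G {x} {a} {b} {c} xa xb xc ab ac bc = Clique4-K4 G vertex λ {i} {j} → edge i j
  where
  vertex : Fin 4 → Fin n
  vertex 0F = x
  vertex 1F = a
  vertex 2F = b
  vertex 3F = c
  edge : ∀ i j → i ≢ j → Adj G (vertex i) (vertex j)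
  edge 0F 1F _ = xa
  edge 0F 2F _ = xb
  edge 0F 3F _ = xc
  edge 1F 2F _ = ab
  edge 1F 3F _ = ac
  edge 2F 3F _ = bc
  edge 1F 0F _ = Adj-sym G xa
  edge 2F 0F _ = Adj-sym G xb
  edge 3F 0F _ = Adj-sym G xc
  edge 2F 1F _ = Adj-sym G ab
  edge 3F 1F _ = Adj-sym G ac
  edge 3F 2F _ = Adj-sym G bc
  edge 0F 0F i≢i = contradiction refl i≢i
  edge 1F 1F i≢i = contradiction refl i≢i
  edge 2F 2F i≢i = contradiction refl i≢i
  edge 3F 3F i≢i = contradiction refl i≢i

K4-neighbourhood : K4Below (suc (suc n)) → (G : Graph (suc (suc n))) → MinDegree3 G → Triangulated G →
                   ∀ {x a b c} → NeighbourhoodIn G x a b c → Distinct3 a b c →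
                   Adj G x a → Adj G x b → Adj G x c → HasK4Minor G
K4-neighbourhood IH G δ tri {x} {a} {b} {c} N[x] abc@(a≢b , a≢c , b≢c) xa xb xc
  with Adj? G a b | Adj? G a c | Adj? G b c
... | yes ab | yes ac | yes bc = K4-clique G xa xb xc ab ac bc
... | _ | no ¬ac | _ =
  K4-path IH G δ tri N[x] abc xa xb xc (only-partner G tri N[x] xa ¬ac)
    (Adj-sym G (only-partner G tri (Among3-reverse ∘ N[x]) xc (¬ac ∘ Adj-sym G))) ¬ac
... | yes ab | yes ac | no ¬bc =
  K4-path IH G δ tri (Among3-swap₁₂ ∘ N[x]) (a≢b ∘ ≡.sym , b≢c , a≢c) xb xa xc (Adj-sym G ab) ac ¬bc
... | no ¬ab | yes ac | _ =
  K4-path IH G δ tri (Among3-swap₂₃ ∘ N[x]) (a≢c , a≢b , b≢c ∘ ≡.sym) xa xc xb ac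
    (Adj-sym G (only-partner G tri (Among3-swap₂₃ ∘ Among3-swap₁₂ ∘ N[x]) xb (¬ab ∘ Adj-sym G))) ¬ab

K4-MinDegree3 : (G : Graph n) → Fin n → MinDegree3 G → HasK4Minor G
K4-MinDegree3 {n} = <-rec (λ n → (G : Graph n) → Fin n → MinDegree3 G → HasK4Minor G) step n
  where
  step : ∀ n → K4Below n → (G : Graph n) → Fin n → MinDegree3 G → HasK4Minor G
  step (suc zero) _ G _ δ with δ zero
  ... | zero , zero , _ , (p≢q , _) , _ = contradiction refl p≢q
  step (suc (suc n)) IH G _ δ with all? (λ v → Four? (Adj? G v))
  ... | yes deg4 = K4-all-Degree≥4 IH G deg4
  ... | no ¬deg4 with any? (λ x → any? λ y → Adj? G x y ×-dec ¬? (commonNeighbour? G x y))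
  ...   | yes (_ , _ , xy , ¬common) = K4-no-common-neighbour IH G δ xy ¬common
  ...   | no ¬lonely
    with x , ¬deg4x ← ¬∀⟶∃¬ _ _ (λ v → Four? (Adj? G v)) ¬deg4
    with a , b , c , abc , xa , xb , xc ← δ x =
    K4-neighbourhood IH G δ tri (Three-among ¬deg4x abc xa xb xc) abc xa xb xc
    where
    tri : Triangulated G
    tri {x} {y} xy with commonNeighbour? G x y
    ... | yes common = common
    ... | no ¬common = contradiction (x , y , xy , ¬common) ¬lonely

-- Drawings with the vertices on a line

Ordered4 : ℕ → ℕ → ℕ → ℕ → Set
Ordered4 p q r s = p < q × q < r × r < s

-- A partial form of Outerplanar: only the vertices in S are placed, at distinct positions in ℕ.
record Drawing (G : Graph n) (S : Pred (Fin n) 0ℓ) (pos : Fin n → ℕ) : Set where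
  field
    injective   : ∀ {u v} → u ∈ S → v ∈ S → pos u ≡ pos v → u ≡ v
    noncrossing : ∀ {a b c d} → a ∈ S → b ∈ S → c ∈ S → d ∈ S → Adj G a b → Adj G c d →
                  ¬ Ordered4 (pos a) (pos c) (pos b) (pos d)
open Drawing public

Leftmost Rightmost : Pred (Fin n) 0ℓ → (Fin n → ℕ) → Fin n → Set
Leftmost  S pos x = ∀ {v} → v ∈ S → v ≢ x → pos x < pos v
Rightmost S pos x = ∀ {v} → v ∈ S → v ≢ x → pos v < pos x

Drawing-⊆ : {G : Graph n} {S T : Pred (Fin n) 0ℓ} {pos : Fin n → ℕ} → T ⊆ S → Drawing G S pos → Drawing G T pos
Drawing-⊆ T⊆S D = record
  { injective   = λ u∈ v∈ → injective D (T⊆S u∈) (T⊆S v∈)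
  ; noncrossing = λ a∈ b∈ c∈ d∈ → noncrossing D (T⊆S a∈) (T⊆S b∈) (T⊆S c∈) (T⊆S d∈)
  }

maxPos : (Fin n → ℕ) → ℕ
maxPos {n} pos = max 0 (List.map pos (List.allFin n))

≤maxPos : (pos : Fin n → ℕ) (v : Fin n) → pos v ≤ maxPos pos
≤maxPos pos v = v≤max⁺ 0 _ (inj₂ (Any.map (λ { refl → ≤-refl }) (∈-map⁺ pos (∈-allFin v))))

-- Rotation making P the least position; crossings survive it because crossing chords stay
-- crossing under cyclic shifts of their four ends.
module Rotation (P M : ℕ) where

  rotate : ℕ → ℕ
  rotate x with P ≤? x
  ... | yes _ = x
  ... | no _  = suc M + x

  rotate-high : ∀ {x} → P ≤ x → rotate x ≡ x
  rotate-high {x} P≤x with P ≤? x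
  ... | yes _   = refl
  ... | no P≰x = contradiction P≤x P≰x

  rotate-low : ∀ {x} → x < P → rotate x ≡ suc M + x
  rotate-low {x} x<P with P ≤? x
  ... | yes P≤x = contradiction P≤x (<⇒≱ x<P)
  ... | no _    = refl

  rotate-injective : ∀ {x y} → x ≤ M → y ≤ M → rotate x ≡ rotate y → x ≡ y
  rotate-injective {x} {y} x≤M y≤M rx≡ry with P ≤? x | P ≤? y
  ... | yes _ | yes _ = rx≡ry
  ... | no _  | no _  = +-cancelˡ-≡ (suc M) x y rx≡ry
  ... | yes _ | no _  = contradiction rx≡ry (<⇒≢ (≤-<-trans x≤M (s≤s (m≤m+n M y))))
  ... | no _  | yes _ = contradiction (≡.sym rx≡ry) (<⇒≢ (≤-<-trans y≤M (s≤s (m≤m+n M x))))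

  P<rotate : ∀ {x} → P ≤ M → P ≢ x → P < rotate x
  P<rotate {x} P≤M P≢x with P ≤? x
  ... | yes P≤x = ≤∧≢⇒< P≤x P≢x
  ... | no _    = ≤-<-trans P≤M (s≤s (m≤m+n M x))

  shifted-above : ∀ {x y} → y ≤ M → ¬ suc M + x < y
  shifted-above y≤M shifted<y = <⇒≱ shifted<y (≤-trans y≤M (≤-trans (n≤1+n M) (m≤m+n (suc M) _)))

  rotate-Ordered4 : ∀ {x y z w} → x ≤ M → y ≤ M → z ≤ M → w ≤ M →
                    Ordered4 (rotate x) (rotate y) (rotate z) (rotate w) →
                    Ordered4 x y z w ⊎ Ordered4 w x y z ⊎ Ordered4 z w x y ⊎ Ordered4 y z w x
  rotate-Ordered4 {x} {y} {z} {w} _ y≤M z≤M w≤M (x<y , y<z , z<w)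
    with P ≤? x | P ≤? y | P ≤? z | P ≤? w
  ... | yes _ | yes _ | yes _ | yes _ = inj₁ (x<y , y<z , z<w)
  ... | yes P≤x | yes _ | yes _ | no P≰w = inj₂ (inj₁ (<-≤-trans (≰⇒> P≰w) P≤x , x<y , y<z))
  ... | yes P≤x | yes _ | no _ | no P≰w =
    inj₂ (inj₂ (inj₁ (+-cancelˡ-< (suc M) _ _ z<w , <-≤-trans (≰⇒> P≰w) P≤x , x<y)))
  ... | yes P≤x | no _ | no _ | no P≰w =
    inj₂ (inj₂ (inj₂ (+-cancelˡ-< (suc M) _ _ y<z , +-cancelˡ-< (suc M) _ _ z<w , <-≤-trans (≰⇒> P≰w) P≤x)))
  ... | no _ | no _ | no _ | no _ =
    inj₁ (+-cancelˡ-< (suc M) _ _ x<y , +-cancelˡ-< (suc M) _ _ y<z , +-cancelˡ-< (suc M) _ _ z<w)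
  ... | no _ | yes _ | _ | _ = ⊥-elim (shifted-above y≤M x<y)
  ... | _ | no _ | yes _ | _ = ⊥-elim (shifted-above z≤M y<z)
  ... | _ | _ | no _ | yes _ = ⊥-elim (shifted-above w≤M z<w)

module Rotate {G : Graph n} {S : Pred (Fin n) 0ℓ} {pos : Fin n → ℕ} (D : Drawing G S pos) (c : Fin n) where
  open Rotation (pos c) (maxPos pos)

  rotated : Fin n → ℕ
  rotated = rotate ∘ pos

  rotated-drawing : Drawing G S rotated
  rotated-drawing .injective u∈ v∈ =
    injective D u∈ v∈ ∘ rotate-injective (≤maxPos pos _) (≤maxPos pos _)
  rotated-drawing .noncrossing {a} {b} {c′} {d} a∈ b∈ c′∈ d∈ ab c′d crossing
    with rotate-Ordered4 (≤maxPos pos a) (≤maxPos pos c′) (≤maxPos pos b) (≤maxPos pos d) crossing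
  ... | inj₁ o               = noncrossing D a∈ b∈ c′∈ d∈ ab c′d o
  ... | inj₂ (inj₁ o)        = noncrossing D d∈ c′∈ a∈ b∈ (Adj-sym G c′d) ab o
  ... | inj₂ (inj₂ (inj₁ o)) = noncrossing D b∈ a∈ d∈ c′∈ (Adj-sym G ab) (Adj-sym G c′d) o
  ... | inj₂ (inj₂ (inj₂ o)) = noncrossing D c′∈ d∈ b∈ a∈ c′d (Adj-sym G ab) o

  rotated-leftmost : c ∈ S → Leftmost S rotated c
  rotated-leftmost c∈S v∈S v≢c rewrite rotate-high (≤-refl {pos c}) =
    P<rotate (≤maxPos pos c) (v≢c ∘ ≡.sym ∘ injective D c∈S v∈S)

  rotated-rightmost : ∀ {x} → pos x < pos c → (∀ {v} → v ∈ S → pos v < pos c → v ≡ x) → Rightmost S rotated x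
  rotated-rightmost {x} x<c below⇒x {v} v∈S v≢x rewrite rotate-low x<c
    with pos c ≤? pos v
  ... | yes _   = s≤s (≤-trans (≤maxPos pos v) (m≤m+n (maxPos pos) (pos x)))
  ... | no c≰v = contradiction (below⇒x v∈S (≰⇒> c≰v)) v≢x

module Reflect {G : Graph n} {S : Pred (Fin n) 0ℓ} {pos : Fin n → ℕ} (D : Drawing G S pos) where

  reflected : Fin n → ℕ
  reflected v = maxPos pos ∸ pos v

  reflected-<⁻ : ∀ {u v} → reflected u < reflected v → pos v < pos u
  reflected-<⁻ {u} {v} ru<rv with pos v <? pos u
  ... | yes v<u = v<u
  ... | no v≮u  = contradiction (∸-monoʳ-≤ (maxPos pos) (≮⇒≥ v≮u)) (<⇒≱ ru<rv)

  reflected-drawing : Drawing G S reflected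
  reflected-drawing .injective u∈ v∈ =
    injective D u∈ v∈ ∘ ∸-cancelˡ-≡ (≤maxPos pos _) (≤maxPos pos _)
  reflected-drawing .noncrossing a∈ b∈ c∈ d∈ ab cd (a<c , c<b , b<d) =
    noncrossing D d∈ c∈ b∈ a∈ (Adj-sym G cd) (Adj-sym G ab)
      (reflected-<⁻ b<d , reflected-<⁻ c<b , reflected-<⁻ a<c)

  leftmost⇒rightmost : ∀ {x} → Leftmost S pos x → Rightmost S reflected x
  leftmost⇒rightmost leftmost v∈S v≢x = ∸-monoʳ-< (leftmost v∈S v≢x) (≤maxPos pos _)

  rightmost⇒leftmost : ∀ {x} → Rightmost S pos x → Leftmost S reflected x
  rightmost⇒leftmost rightmost v∈S v≢x = ∸-monoʳ-< (rightmost v∈S v≢x) (≤maxPos pos _)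

module Glue {G : Graph n} {S T : Pred (Fin n) 0ℓ} (T? : Decidable T) {posS posT : Fin n → ℕ}
  (DS : Drawing G S posS) (DT : Drawing G T posT) {c : Fin n} (c∈S : c ∈ S) (c∈T : c ∈ T)
  (c-leftmost : Leftmost T posT c)
  (meet : ∀ {v} → v ∈ S → v ∈ T → v ≡ c)
  (separated : ∀ {u v} → u ∈ S → v ∈ T → Adj G u v → u ≡ c ⊎ v ≡ c) where

  -- T is drawn in the gap just after c: positions are the pairs (posS , posT) in lexicographic
  -- order, S-vertices at (posS v , posT c) and T-vertices at (posS c , posT v).
  width : ℕ
  width = suc (maxPos posT)

  pair : ℕ → ℕ → ℕ
  pair x y = width * x + y

  posT<width : ∀ v → posT v < width
  posT<width v = s≤s (≤maxPos posT v)

  pair-<⁺ : ∀ {x x′ y y′} → y < width → x < x′ → pair x y < pair x′ y′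
  pair-<⁺ {x} {x′} {y} {y′} y<w x<x′ = begin-strict
    width * x + y     <⟨ +-monoʳ-< (width * x) y<w ⟩
    width * x + width ≡⟨ +-comm (width * x) width ⟩
    width + width * x ≡⟨ *-suc width x ⟨
    width * suc x     ≤⟨ *-monoʳ-≤ width x<x′ ⟩
    width * x′        ≤⟨ m≤m+n (width * x′) y′ ⟩
    width * x′ + y′   ∎
    where open ≤-Reasoning

  pair-<⁻ : ∀ {x x′ y y′} → y < width → y′ < width → pair x y < pair x′ y′ → x < x′ ⊎ (x ≡ x′ × y < y′)
  pair-<⁻ {x} {x′} y<w y′<w xy<x′y′ with <-cmp x x′
  ... | tri< x<x′ _ _ = inj₁ x<x′
  ... | tri≈ _ refl _ = inj₂ (refl , +-cancelˡ-< (width * x) _ _ xy<x′y′)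
  ... | tri> _ _ x′<x = contradiction xy<x′y′ (<-asym (pair-<⁺ y′<w x′<x))

  pair-injective : ∀ {x x′ y y′} → y < width → y′ < width → pair x y ≡ pair x′ y′ → x ≡ x′ × y ≡ y′
  pair-injective {x} {x′} y<w y′<w xy≡x′y′ with <-cmp x x′
  ... | tri< x<x′ _ _ = contradiction xy≡x′y′ (<⇒≢ (pair-<⁺ y<w x<x′))
  ... | tri≈ _ refl _ = refl , +-cancelˡ-≡ (width * x) _ _ xy≡x′y′
  ... | tri> _ _ x′<x = contradiction (≡.sym xy≡x′y′) (<⇒≢ (pair-<⁺ y′<w x′<x))

  glued : Fin n → ℕ
  glued v = if does (T? v) then pair (posS c) (posT v) else pair (posS v) (posT c)

  glued-T : ∀ {v} → v ∈ T → glued v ≡ pair (posS c) (posT v)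
  glued-T {v} v∈T with T? v
  ... | yes _   = refl
  ... | no v∉T = contradiction v∈T v∉T

  glued-S : ∀ {v} → v ∈ S → glued v ≡ pair (posS v) (posT c)
  glued-S {v} v∈S with T? v
  ... | yes v∈T rewrite meet v∈S v∈T = refl
  ... | no _    = refl

  via : ∀ {u v a b} → glued u ≡ a → glued v ≡ b → glued u ≡ glued v → a ≡ b
  via gu≡a gv≡b gu≡gv = trans (≡.sym gu≡a) (trans gu≡gv gv≡b)

  T-above-c : ∀ {v} → v ∈ T → posT c ≤ posT v
  T-above-c {v} v∈T with v ≟ c
  ... | yes refl = ≤-refl
  ... | no v≢c   = <⇒≤ (c-leftmost v∈T v≢c)

  S-<⁻ : ∀ {u v} → u ∈ S → v ∈ S → glued u < glued v → posS u < posS v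
  S-<⁻ u∈ v∈ gu<gv with pair-<⁻ (posT<width c) (posT<width c) (subst₂ _<_ (glued-S u∈) (glued-S v∈) gu<gv)
  ... | inj₁ u<v          = u<v
  ... | inj₂ (_ , c<c)    = contradiction c<c (<-irrefl refl)

  T-<⁻ : ∀ {u v} → u ∈ T → v ∈ T → glued u < glued v → posT u < posT v
  T-<⁻ u∈ v∈ gu<gv with pair-<⁻ (posT<width _) (posT<width _) (subst₂ _<_ (glued-T u∈) (glued-T v∈) gu<gv)
  ... | inj₁ c<c       = contradiction c<c (<-irrefl refl)
  ... | inj₂ (_ , u<v) = u<v

  S-outside-T : ∀ {x y z} → x ∈ T → y ∈ T → z ∈ S → glued x < glued z → glued z < glued y → ⊥
  S-outside-T x∈ y∈ z∈ gx<gz gz<gy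
    with pair-<⁻ (posT<width _) (posT<width c) (subst₂ _<_ (glued-T x∈) (glued-S z∈) gx<gz)
       | pair-<⁻ (posT<width c) (posT<width _) (subst₂ _<_ (glued-S z∈) (glued-T y∈) gz<gy)
  ... | inj₂ (_ , x<c) | _              = <⇒≱ x<c (T-above-c x∈)
  ... | inj₁ c<z       | inj₁ z<c       = <-asym c<z z<c
  ... | inj₁ c<z       | inj₂ (z≡c , _) = <-irrefl (≡.sym z≡c) c<z

  edge-side : ∀ {u v} → u ∈ S ∪ T → v ∈ S ∪ T → Adj G u v → (u ∈ S × v ∈ S) ⊎ (u ∈ T × v ∈ T)
  edge-side (inj₁ u∈S) (inj₁ v∈S) _ = inj₁ (u∈S , v∈S)
  edge-side (inj₂ u∈T) (inj₂ v∈T) _ = inj₂ (u∈T , v∈T)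
  edge-side (inj₁ u∈S) (inj₂ v∈T) uv with separated u∈S v∈T uv
  ... | inj₁ u≡c = inj₂ (subst T (≡.sym u≡c) c∈T , v∈T)
  ... | inj₂ v≡c = inj₁ (u∈S , subst S (≡.sym v≡c) c∈S)
  edge-side (inj₂ u∈T) (inj₁ v∈S) uv with separated v∈S u∈T (Adj-sym G uv)
  ... | inj₁ v≡c = inj₂ (u∈T , subst T (≡.sym v≡c) c∈T)
  ... | inj₂ u≡c = inj₁ (subst S (≡.sym u≡c) c∈S , v∈S)

  glued-drawing : Drawing G (S ∪ T) glued
  glued-drawing .injective {u} {v} (inj₁ u∈S) (inj₁ v∈S) gu≡gv
    with u≡v , _ ← pair-injective (posT<width c) (posT<width c) (via (glued-S u∈S) (glued-S v∈S) gu≡gv)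
    = injective DS u∈S v∈S u≡v
  glued-drawing .injective {u} {v} (inj₂ u∈T) (inj₂ v∈T) gu≡gv
    with _ , u≡v ← pair-injective (posT<width u) (posT<width v) (via (glued-T u∈T) (glued-T v∈T) gu≡gv)
    = injective DT u∈T v∈T u≡v
  glued-drawing .injective {u} {v} (inj₁ u∈S) (inj₂ v∈T) gu≡gv
    with u≡c , c≡v ← pair-injective (posT<width c) (posT<width v) (via (glued-S u∈S) (glued-T v∈T) gu≡gv)
    = trans (injective DS u∈S c∈S u≡c) (injective DT c∈T v∈T c≡v)
  glued-drawing .injective {u} {v} (inj₂ u∈T) (inj₁ v∈S) gu≡gv
    with c≡v , u≡c ← pair-injective (posT<width u) (posT<width c) (via (glued-T u∈T) (glued-S v∈S) gu≡gv)
    = trans (injective DT u∈T c∈T u≡c) (injective DS c∈S v∈S c≡v)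
  glued-drawing .noncrossing a∈ b∈ c∈ d∈ ab cd (a<c , c<b , b<d) with edge-side a∈ b∈ ab | edge-side c∈ d∈ cd
  ... | inj₁ (a∈S , b∈S) | inj₁ (c∈S , d∈S) =
    noncrossing DS a∈S b∈S c∈S d∈S ab cd (S-<⁻ a∈S c∈S a<c , S-<⁻ c∈S b∈S c<b , S-<⁻ b∈S d∈S b<d)
  ... | inj₂ (a∈T , b∈T) | inj₂ (c∈T , d∈T) =
    noncrossing DT a∈T b∈T c∈T d∈T ab cd (T-<⁻ a∈T c∈T a<c , T-<⁻ c∈T b∈T c<b , T-<⁻ b∈T d∈T b<d)
  ... | inj₁ (_ , b∈S) | inj₂ (c∈T , d∈T) = S-outside-T c∈T d∈T b∈S c<b b<d
  ... | inj₂ (a∈T , b∈T) | inj₁ (c∈S , _) = S-outside-T a∈T b∈T c∈S a<c c<b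

  glued-leftmost : Leftmost S posS c → Leftmost (S ∪ T) glued c
  glued-leftmost c-leftmostS {v} (inj₁ v∈S) v≢c = subst₂ _<_ (≡.sym (glued-S c∈S)) (≡.sym (glued-S v∈S))
    (pair-<⁺ (posT<width c) (c-leftmostS v∈S v≢c))
  glued-leftmost c-leftmostS {v} (inj₂ v∈T) v≢c = subst₂ _<_ (≡.sym (glued-T c∈T)) (≡.sym (glued-T v∈T))
    (+-monoʳ-< (width * posS c) (c-leftmost v∈T v≢c))

  glued-rightmost : ∀ {x} → x ∈ S → x ≢ c → Rightmost S posS x → Rightmost (S ∪ T) glued x
  glued-rightmost x∈S x≢c x-rightmost {v} (inj₁ v∈S) v≢x = subst₂ _<_ (≡.sym (glued-S v∈S)) (≡.sym (glued-S x∈S))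
    (pair-<⁺ (posT<width c) (x-rightmost v∈S v≢x))
  glued-rightmost x∈S x≢c x-rightmost {v} (inj₂ v∈T) v≢x = subst₂ _<_ (≡.sym (glued-T v∈T)) (≡.sym (glued-S x∈S))
    (pair-<⁺ (posT<width v) (x-rightmost c∈S (x≢c ∘ ≡.sym)))

-- w is placed after all other vertices, so its edges, which end at extreme vertices, cross nothing.
module Insert {G : Graph (suc m)} {w : Fin (suc m)} {G′ : Graph m} {pos′ : Fin m → ℕ}
  (kept : ∀ {i j} → Adj G (punchIn w i) (punchIn w j) → Adj G′ i j)
  (D′ : Drawing G′ U pos′)
  (extreme : ∀ {i} → Adj G w (punchIn w i) → Leftmost U pos′ i ⊎ Rightmost U pos′ i) where

  top : ℕ
  top = suc (maxPos pos′)

  position : ∀ {v} → Punched w v → ℕ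
  position pivot       = top
  position (punched i) = pos′ i

  inserted : Fin (suc m) → ℕ
  inserted v = position (punched? w v)

  pos′<top : ∀ i → pos′ i < top
  pos′<top i = s≤s (≤maxPos pos′ i)

  position≤top : ∀ {v} (p : Punched w v) → position p ≤ top
  position≤top pivot       = ≤-refl
  position≤top (punched i) = <⇒≤ (pos′<top i)

  inserted-drawing : Drawing G U inserted
  inserted-drawing .injective {u} {v} _ _ pu≡pv with punched? w u | punched? w v
  ... | pivot     | pivot     = refl
  ... | punched i | punched j = cong (punchIn w) (injective D′ _ _ pu≡pv)
  ... | pivot     | punched j = contradiction (≡.sym pu≡pv) (<⇒≢ (pos′<top j))
  ... | punched i | pivot     = contradiction pu≡pv (<⇒≢ (pos′<top i))
  inserted-drawing .noncrossing {a} {b} {c} {d} _ _ _ _ ab cd (a<c , c<b , b<d)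
    with punched? w a | punched? w b | punched? w c | punched? w d
  ... | pivot | _ | pc | _ = <⇒≱ a<c (position≤top pc)
  ... | _ | pivot | _ | pd = <⇒≱ b<d (position≤top pd)
  ... | _ | pb | pivot | _ = <⇒≱ c<b (position≤top pb)
  ... | punched i | punched j | punched k | punched l =
    noncrossing D′ _ _ _ _ (kept ab) (kept cd) (a<c , c<b , b<d)
  ... | punched i | punched j | punched k | pivot with extreme (Adj-sym G cd)
  ...   | inj₁ k-leftmost  = <-asym a<c (k-leftmost _ λ { refl → <-irrefl refl a<c })
  ...   | inj₂ k-rightmost = <-asym c<b (k-rightmost _ λ { refl → <-irrefl refl c<b })

module _ {G : Graph n} {pos : Fin n → ℕ} (D : Drawing G U pos) where
  below : Fin n → Subset n
  below v = subset (λ u → pos u <? pos v)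

  rank : Fin n → ℕ
  rank v = ∣ below v ∣

  below-⊂ : ∀ {u v} → pos u < pos v → below u ⊂ₛ below v
  below-⊂ {u} {v} u<v =
    (λ t∈ → ∈-subset⁺ (below? v) (<-trans (∈-subset⁻ (below? u) t∈) u<v)) , u , ∈-subset⁺ (below? v) u<v ,
    λ u∈ → <-irrefl refl (∈-subset⁻ (below? u) u∈)
    where below? = λ v t → pos t <? pos v

  rank<n : ∀ v → rank v < n
  rank<n v = subst (rank v <_) (∣⊤∣≡n n)
    (p⊂q⇒∣p∣<∣q∣ (⊆⊤ , v , ∈⊤ , λ v∈ → <-irrefl refl (∈-subset⁻ (λ t → pos t <? pos v) v∈)))

  rank-<⁻ : ∀ {u v} → rank u < rank v → pos u < pos v
  rank-<⁻ {u} {v} ru<rv with <-cmp (pos u) (pos v)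
  ... | tri< u<v _ _ = u<v
  ... | tri≈ _ u≡v _ with refl ← injective D _ _ u≡v = contradiction ru<rv (<-irrefl refl)
  ... | tri> _ _ v<u = contradiction ru<rv (<-asym (p⊂q⇒∣p∣<∣q∣ (below-⊂ v<u)))

  order : Fin n → Fin n
  order v = fromℕ< (rank<n v)

  toℕ-order : ∀ v → toℕ (order v) ≡ rank v
  toℕ-order v = toℕ-fromℕ< (rank<n v)

  order-<⁺ : ∀ {u v} → pos u < pos v → toℕ (order u) < toℕ (order v)
  order-<⁺ {u} {v} = subst₂ _<_ (≡.sym (toℕ-order u)) (≡.sym (toℕ-order v)) ∘ p⊂q⇒∣p∣<∣q∣ ∘ below-⊂

  order-<⁻ : ∀ {u v} → toℕ (order u) < toℕ (order v) → pos u < pos v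
  order-<⁻ {u} {v} = rank-<⁻ ∘ subst₂ _<_ (toℕ-order u) (toℕ-order v)

  order-injective : ∀ {u v} → order u ≡ order v → u ≡ v
  order-injective {u} {v} ou≡ov with <-cmp (pos u) (pos v)
  ... | tri< u<v _ _ = contradiction (cong toℕ ou≡ov) (<⇒≢ (order-<⁺ u<v))
  ... | tri≈ _ u≡v _ = injective D _ _ u≡v
  ... | tri> _ _ v<u = contradiction (cong toℕ (≡.sym ou≡ov)) (<⇒≢ (order-<⁺ v<u))

  order-surjective : ∀ y → ∃ λ x → ∀ {z} → z ≡ x → order z ≡ y
  order-surjective y with x , ox≡y ← injective⇒surjective order order-injective y = x , λ { refl → ox≡y }

  Drawing⇒Outerplanar : Outerplanar G
  Drawing⇒Outerplanar = ⤖⇒↔ (mk⤖ (order-injective , order-surjective)) , λ a b c d ab cd (a<c , c<b , b<d) →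
    noncrossing D _ _ _ _ ab cd (order-<⁻ a<c , order-<⁻ c<b , order-<⁻ b<d)

EndsDrawn : Graph n → Pred (Fin n) 0ℓ → Fin n → Fin n → Set
EndsDrawn G S x y = ∃ λ pos → Drawing G S pos × Leftmost S pos x × Rightmost S pos y

glue-at-ends : {G : Graph n} {S X Y : Pred (Fin n) 0ℓ} {pos₀ : Fin n → ℕ} {x y : Fin n} →
               Decidable X → Decidable Y → Drawing G U pos₀ → EndsDrawn G S x y →
               x ∈ S → y ∈ S → x ∈ X → y ∈ Y → x ≢ y →
               (∀ {v} → v ∈ S → v ∈ X → v ≡ x) → (∀ {u v} → u ∈ S → v ∈ X → Adj G u v → u ≡ x ⊎ v ≡ x) →
               (∀ {v} → v ∈ S ∪ X → v ∈ Y → v ≡ y) → (∀ {u v} → u ∈ S ∪ X → v ∈ Y → Adj G u v → u ≡ y ⊎ v ≡ y) →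
               EndsDrawn G ((S ∪ X) ∪ Y) y x
glue-at-ends {G = G} {S} {X} {Y} {x = x} {y} X? Y? D₀ (pos , D , x-leftmost , y-rightmost)
             x∈S y∈S x∈X y∈Y x≢y meetX sepX meetY sepY =
  GY.glued , GY.glued-drawing , GY.glued-leftmost (R.rightmost⇒leftmost y-rightmost′) ,
  GY.glued-rightmost (inj₁ x∈S) x≢y (R.leftmost⇒rightmost x-leftmost′)
  where
  module RX = Rotate (Drawing-⊆ (λ _ → _) D₀) x
  module GX = Glue X? D RX.rotated-drawing x∈S x∈X (RX.rotated-leftmost x∈X) meetX sepX
  x-leftmost′ : Leftmost (S ∪ X) GX.glued x
  x-leftmost′ = GX.glued-leftmost x-leftmost
  y-rightmost′ : Rightmost (S ∪ X) GX.glued y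
  y-rightmost′ = GX.glued-rightmost y∈S (x≢y ∘ ≡.sym) y-rightmost
  module R = Reflect GX.glued-drawing
  module RY = Rotate (Drawing-⊆ (λ _ → _) D₀) y
  module GY = Glue Y? R.reflected-drawing RY.rotated-drawing (inj₁ y∈S) y∈Y (RY.rotated-leftmost y∈Y) meetY sepY

EndsDrawn-⊆ : {G : Graph n} {S T : Pred (Fin n) 0ℓ} {x y : Fin n} → T ⊆ S → EndsDrawn G S x y → EndsDrawn G T x y
EndsDrawn-⊆ T⊆S (pos , D , x-leftmost , y-rightmost) =
  pos , Drawing-⊆ T⊆S D , (λ v∈ → x-leftmost (T⊆S v∈)) , (λ v∈ → y-rightmost (T⊆S v∈))

ends-extreme : {G : Graph n} {S : Pred (Fin n) 0ℓ} {x y : Fin n} → EndsDrawn G S x y ⊎ EndsDrawn G S y x →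
               ∃ λ pos → Drawing G S pos × (∀ {v} → v ≡ x ⊎ v ≡ y → Leftmost S pos v ⊎ Rightmost S pos v)
ends-extreme (inj₁ (pos , D , x-leftmost , y-rightmost)) = pos , D , λ where
  (inj₁ refl) → inj₁ x-leftmost
  (inj₂ refl) → inj₂ y-rightmost
ends-extreme (inj₂ (pos , D , y-leftmost , x-rightmost)) = pos , D , λ where
  (inj₁ refl) → inj₂ x-rightmost
  (inj₂ refl) → inj₁ y-leftmost

-- Bridges of an edge

module _ (G : Graph n) where

  EdgeAvoiding-sym : ∀ {u v a b} → EdgeAvoiding G u v a b → EdgeAvoiding G u v b a
  EdgeAvoiding-sym (ab , a-off , b-off) = Adj-sym G ab , b-off , a-off

  ConnectedAvoiding-off : ∀ {u v x y} → ConnectedAvoiding G u v x y → (x ≢ u × x ≢ v) → (y ≢ u × y ≢ v)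
  ConnectedAvoiding-off ε              x-off = x-off
  ConnectedAvoiding-off ((_ , _ , x′-off) ◅ x′↝y) _ = ConnectedAvoiding-off x′↝y x′-off

  ComponentTouches-pre : ∀ {u v x y t} → ConnectedAvoiding G u v x y →
                         ComponentTouches G u v y t → ComponentTouches G u v x t
  ComponentTouches-pre x↝y (z , y↝z , zt) = z , x↝y ◅◅ y↝z , zt

  edgeAvoiding? : ∀ u v a b → Dec (EdgeAvoiding G u v a b)
  edgeAvoiding? u v a b = Adj? G a b ×-dec (¬? (a ≟ u) ×-dec ¬? (a ≟ v)) ×-dec (¬? (b ≟ u) ×-dec ¬? (b ≟ v))

  connectedAvoiding? : ∀ u v x y → Dec (ConnectedAvoiding G u v x y)
  connectedAvoiding? u v = star? (edgeAvoiding? u v)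

  componentTouches? : ∀ u v x t → Dec (ComponentTouches G u v x t)
  componentTouches? u v x t = any? λ y → connectedAvoiding? u v x y ×-dec Adj? G y t

  bridgeRep? : ∀ u v x → Dec (BridgeRep G u v x)
  bridgeRep? u v x = (¬? (x ≟ u) ×-dec ¬? (x ≟ v)) ×-dec componentTouches? u v x u ×-dec componentTouches? u v x v

  SingleBridge : Fin n → Fin n → Set
  SingleBridge u v = ∀ {x y} → BridgeRep G u v x → BridgeRep G u v y → ConnectedAvoiding G u v x y

module Pieces (G : Graph n) {α β : Fin n} (αβ : Adj G α β) where

  Off : Pred (Fin n) 0ℓ
  Off v = v ≢ α × v ≢ β

  Touches : Fin n → Pred (Fin n) 0ℓ
  Touches t v = ComponentTouches G α β v t

  -- Hangα collects the bridges attached to α only (or to neither of α and β), Hangβ those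
  -- attached to β only.
  Core Hangα Hangβ : Pred (Fin n) 0ℓ
  Core  v = v ≡ α ⊎ v ≡ β ⊎ BridgeRep G α β v
  Hangα v = v ≡ α ⊎ (Off v × ¬ Touches β v)
  Hangβ v = v ≡ β ⊎ (Off v × Touches β v × ¬ Touches α v)

  hangα? : Decidable Hangα
  hangα? v = v ≟ α ⊎-dec ((¬? (v ≟ α) ×-dec ¬? (v ≟ β)) ×-dec ¬? (componentTouches? G α β v β))

  hangβ? : Decidable Hangβ
  hangβ? v = v ≟ β ⊎-dec ((¬? (v ≟ α) ×-dec ¬? (v ≟ β)) ×-dec componentTouches? G α β v β ×-dec
                          ¬? (componentTouches? G α β v α))

  classify : ∀ v → Core v ⊎ Hangα v ⊎ Hangβ v
  classify v with v ≟ α | v ≟ β | componentTouches? G α β v β | componentTouches? G α β v α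
  ... | yes v≡α | _ | _ | _ = inj₁ (inj₁ v≡α)
  ... | no _ | yes v≡β | _ | _ = inj₁ (inj₂ (inj₁ v≡β))
  ... | no v≢α | no v≢β | no ¬tβ | _ = inj₂ (inj₁ (inj₂ ((v≢α , v≢β) , ¬tβ)))
  ... | no v≢α | no v≢β | yes tβ | yes tα = inj₁ (inj₂ (inj₂ ((v≢α , v≢β) , tα , tβ)))
  ... | no v≢α | no v≢β | yes tβ | no ¬tα = inj₂ (inj₂ (inj₂ ((v≢α , v≢β) , tβ , ¬tα)))

  touches-across : ∀ {u v t} → Off u → Off v → Adj G u v → Touches t v → Touches t u
  touches-across u-off v-off uv = ComponentTouches-pre G ((uv , u-off , v-off) ◅ ε)

  touches-directly : ∀ {v t} → Adj G v t → Touches t v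
  touches-directly {v} vt = v , ε , vt

  hangα-meet : ∀ {v} → v ∈ Core ∪ Hangβ → v ∈ Hangα → v ≡ α
  hangα-meet _ (inj₁ v≡α) = v≡α
  hangα-meet (inj₁ (inj₁ v≡α)) _ = v≡α
  hangα-meet (inj₁ (inj₂ (inj₁ v≡β))) (inj₂ ((_ , v≢β) , _)) = contradiction v≡β v≢β
  hangα-meet (inj₁ (inj₂ (inj₂ (_ , _ , tβ)))) (inj₂ (_ , ¬tβ)) = contradiction tβ ¬tβ
  hangα-meet (inj₂ (inj₁ v≡β)) (inj₂ ((_ , v≢β) , _)) = contradiction v≡β v≢β
  hangα-meet (inj₂ (inj₂ (_ , tβ , _))) (inj₂ (_ , ¬tβ)) = contradiction tβ ¬tβ

  hangβ-meet : ∀ {v} → v ∈ Core ∪ Hangα → v ∈ Hangβ → v ≡ β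
  hangβ-meet _ (inj₁ v≡β) = v≡β
  hangβ-meet (inj₁ (inj₁ v≡α)) (inj₂ ((v≢α , _) , _)) = contradiction v≡α v≢α
  hangβ-meet (inj₁ (inj₂ (inj₁ v≡β))) _ = v≡β
  hangβ-meet (inj₁ (inj₂ (inj₂ (_ , tα , _)))) (inj₂ (_ , _ , ¬tα)) = contradiction tα ¬tα
  hangβ-meet (inj₂ (inj₁ v≡α)) (inj₂ ((v≢α , _) , _)) = contradiction v≡α v≢α
  hangβ-meet (inj₂ (inj₂ (_ , ¬tβ))) (inj₂ (_ , tβ , _)) = contradiction tβ ¬tβ

  hangα-separated : ∀ {u v} → u ∈ Core ∪ Hangβ → v ∈ Hangα → Adj G u v → u ≡ α ⊎ v ≡ α
  hangα-separated _ (inj₁ v≡α) _ = inj₂ v≡α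
  hangα-separated (inj₁ (inj₁ u≡α)) _ _ = inj₁ u≡α
  hangα-separated (inj₁ (inj₂ (inj₁ refl))) (inj₂ (v-off , ¬tβ)) uv =
    contradiction (touches-directly (Adj-sym G uv)) ¬tβ
  hangα-separated (inj₁ (inj₂ (inj₂ (u-off , _ , tβ)))) (inj₂ (v-off , ¬tβ)) uv =
    contradiction (touches-across v-off u-off (Adj-sym G uv) tβ) ¬tβ
  hangα-separated (inj₂ (inj₁ refl)) (inj₂ (v-off , ¬tβ)) uv =
    contradiction (touches-directly (Adj-sym G uv)) ¬tβ
  hangα-separated (inj₂ (inj₂ (u-off , tβ , _))) (inj₂ (v-off , ¬tβ)) uv =
    contradiction (touches-across v-off u-off (Adj-sym G uv) tβ) ¬tβ

  hangβ-separated : ∀ {u v} → u ∈ Core ∪ Hangα → v ∈ Hangβ → Adj G u v → u ≡ β ⊎ v ≡ β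
  hangβ-separated _ (inj₁ v≡β) _ = inj₂ v≡β
  hangβ-separated (inj₁ (inj₁ refl)) (inj₂ (v-off , _ , ¬tα)) uv =
    contradiction (touches-directly (Adj-sym G uv)) ¬tα
  hangβ-separated (inj₁ (inj₂ (inj₁ u≡β))) _ _ = inj₁ u≡β
  hangβ-separated (inj₁ (inj₂ (inj₂ (u-off , tα , _)))) (inj₂ (v-off , _ , ¬tα)) uv =
    contradiction (touches-across v-off u-off (Adj-sym G uv) tα) ¬tα
  hangβ-separated (inj₂ (inj₁ refl)) (inj₂ (v-off , _ , ¬tα)) uv =
    contradiction (touches-directly (Adj-sym G uv)) ¬tα
  hangβ-separated (inj₂ (inj₂ (u-off , ¬tβ))) (inj₂ (v-off , tβ , _)) uv =
    contradiction (touches-across u-off v-off uv tβ) ¬tβ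

  α≢β : α ≢ β
  α≢β = Adj⇒≢ G αβ

  α∈Core : α ∈ Core
  α∈Core = inj₁ refl

  β∈Core : β ∈ Core
  β∈Core = inj₂ (inj₁ refl)

  BridgeRep∈Core : ∀ {v} → BridgeRep G α β v → v ∈ Core
  BridgeRep∈Core = inj₂ ∘ inj₂

  BridgeRep-step : ∀ {u v} → EdgeAvoiding G α β u v → BridgeRep G α β u → BridgeRep G α β v
  BridgeRep-step uv@(_ , u-off , v-off) (_ , tα , tβ) =
    v-off , touches-across v-off u-off vu tα , touches-across v-off u-off vu tβ
    where vu = Adj-sym G (proj₁ uv)

  module CoreDrawing {pos₀ : Fin n → ℕ} (D₀ : Drawing G U pos₀) (single : SingleBridge G α β) where

    module R₁ = Rotate (Drawing-⊆ {S = U} {T = Core} (λ _ → _) D₀) α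
    open R₁ using () renaming (rotated to pos₁; rotated-drawing to D₁)

    α-leftmost : Leftmost Core pos₁ α
    α-leftmost = R₁.rotated-leftmost α∈Core

    -- With α leftmost, an avoiding path cannot pass β without crossing the edge αβ.
    bridge-stays-below : ∀ {k y} → BridgeRep G α β k → pos₁ k < pos₁ β →
                         ConnectedAvoiding G α β k y → pos₁ y < pos₁ β
    bridge-stays-below k-rep k<β ε = k<β
    bridge-stays-below {k} k-rep k<β (kk′@(k~k′ , (k≢α , _) , (_ , k′≢β)) ◅ k′↝y) =
      bridge-stays-below k′-rep k′<β k′↝y
      where
      k′-rep = BridgeRep-step kk′ k-rep
      k′<β : pos₁ _ < pos₁ β
      k′<β with <-cmp (pos₁ _) (pos₁ β)
      ... | tri< k′<β _ _ = k′<β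
      ... | tri≈ _ k′≡β _ = contradiction (injective D₁ (BridgeRep∈Core k′-rep) β∈Core k′≡β) k′≢β
      ... | tri> _ _ β<k′ =
        contradiction (α-leftmost (BridgeRep∈Core k-rep) k≢α , k<β , β<k′)
          (noncrossing D₁ α∈Core β∈Core (BridgeRep∈Core k-rep) (BridgeRep∈Core k′-rep) αβ k~k′)

    core-drawing : EndsDrawn G Core α β ⊎ EndsDrawn G Core β α
    core-drawing with any? (λ v → bridgeRep? G α β v ×-dec pos₁ v <? pos₁ β)
    ... | yes (k , k-rep , k<β) = inj₁ (pos₁ , D₁ , α-leftmost , β-rightmost)
      where
      β-rightmost : Rightmost Core pos₁ β
      β-rightmost (inj₁ refl)          _   = α-leftmost β∈Core (α≢β ∘ ≡.sym)
      β-rightmost (inj₂ (inj₁ refl))   β≢β = contradiction refl β≢β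
      β-rightmost (inj₂ (inj₂ v-rep))  _   = bridge-stays-below k-rep k<β (single k-rep v-rep)
    ... | no none = inj₂ (R₂.rotated , R₂.rotated-drawing , R₂.rotated-leftmost β∈Core ,
                          R₂.rotated-rightmost (α-leftmost β∈Core (α≢β ∘ ≡.sym)) only-α)
      where
      module R₂ = Rotate D₁ β
      only-α : ∀ {v} → v ∈ Core → pos₁ v < pos₁ β → v ≡ α
      only-α (inj₁ v≡α)          _   = v≡α
      only-α (inj₂ (inj₁ refl))  β<β = contradiction β<β (<-irrefl refl)
      only-α (inj₂ (inj₂ v-rep)) v<β = contradiction (_ , v-rep , v<β) none

  covered-αβ : ∀ v → v ∈ (Core ∪ Hangα) ∪ Hangβ
  covered-αβ v with classify v
  ... | inj₁ v∈Core        = inj₁ (inj₁ v∈Core)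
  ... | inj₂ (inj₁ v∈Hang) = inj₁ (inj₂ v∈Hang)
  ... | inj₂ (inj₂ v∈Hang) = inj₂ v∈Hang

  covered-βα : ∀ v → v ∈ (Core ∪ Hangβ) ∪ Hangα
  covered-βα v with classify v
  ... | inj₁ v∈Core        = inj₁ (inj₁ v∈Core)
  ... | inj₂ (inj₁ v∈Hang) = inj₂ v∈Hang
  ... | inj₂ (inj₂ v∈Hang) = inj₁ (inj₂ v∈Hang)

  outer-edge-drawing : ∀ {pos₀} → Drawing G U pos₀ → SingleBridge G α β → EndsDrawn G U α β ⊎ EndsDrawn G U β α
  outer-edge-drawing D₀ single with CoreDrawing.core-drawing D₀ single
  ... | inj₁ ends = inj₂ (EndsDrawn-⊆ (λ {v} _ → covered-αβ v)
    (glue-at-ends hangα? hangβ? D₀ ends α∈Core β∈Core (inj₁ refl) (inj₁ refl) α≢β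
                  (hangα-meet ∘ inj₁) (hangα-separated ∘ inj₁) hangβ-meet hangβ-separated))
  ... | inj₂ ends = inj₁ (EndsDrawn-⊆ (λ {v} _ → covered-βα v)
    (glue-at-ends hangβ? hangα? D₀ ends β∈Core α∈Core (inj₁ refl) (inj₁ refl) (α≢β ∘ ≡.sym)
                  (hangβ-meet ∘ inj₁) (hangβ-separated ∘ inj₁) hangα-meet hangα-separated))

-- Removing a vertex of degree at most two

NoTwoCut : Graph n → Set
NoTwoCut G = ∀ u v → ¬ NontrivialTwoCut G u v

-- G′ is G without w, where w has no neighbours besides α and β and the only new edges join α to
-- neighbours of w: deleting a vertex of degree at most one, or contracting one of degree two into α.
record Reduction (G : Graph (suc m)) (w : Fin (suc m)) (G′ : Graph m) (α β : Fin m) : Set where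
  field
    kept       : ∀ {i j} → Adj G (punchIn w i) (punchIn w j) → Adj G′ i j
    origin     : ∀ {i j} → Adj G′ i j → Adj G (punchIn w i) (punchIn w j)
                   ⊎ ((i ≡ α × Adj G w (punchIn w j)) ⊎ (j ≡ α × Adj G (punchIn w i) w))
    neighbours : ∀ {x} → Adj G w x → x ≡ punchIn w α ⊎ x ≡ punchIn w β
    joined     : Adj G w (punchIn w β) → α ≢ β → Adj G′ α β
    hub        : ∀ {x} → Adj G w x → Adj G w (punchIn w α)

module _ {G : Graph (suc m)} {w : Fin (suc m)} {G′ : Graph m} {α β : Fin m} (R : Reduction G w G′ α β) where
  open Reduction R

  private
    π : Fin m → Fin (suc m)
    π = punchIn w

    π-off : ∀ {i u′ v′} → i ≢ u′ × i ≢ v′ → π i ≢ π u′ × π i ≢ π v′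
    π-off (i≢u′ , i≢v′) = i≢u′ ∘ punchIn-injective w _ _ , i≢v′ ∘ punchIn-injective w _ _

    w-off : ∀ {u′ v′} → w ≢ π u′ × w ≢ π v′
    w-off = punchInᵢ≢i w _ ∘ ≡.sym , punchInᵢ≢i w _ ∘ ≡.sym

  module Lift {u′ v′ : Fin m} where

    lift-edge : ∀ {i j} → EdgeAvoiding G′ u′ v′ i j → ConnectedAvoiding G (π u′) (π v′) (π i) (π j)
    lift-edge (ij , i-off , j-off) with origin ij
    ... | inj₁ πij = (πij , π-off i-off , π-off j-off) ◅ ε
    ... | inj₂ (inj₁ (refl , wj)) = (Adj-sym G (hub wj) , π-off i-off , w-off) ◅ (wj , w-off , π-off j-off) ◅ ε
    ... | inj₂ (inj₂ (refl , iw)) = (iw , π-off i-off , w-off) ◅ (hub (Adj-sym G iw) , w-off , π-off j-off) ◅ ε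

    lift : ∀ {i j} → ConnectedAvoiding G′ u′ v′ i j → ConnectedAvoiding G (π u′) (π v′) (π i) (π j)
    lift = Star.kleisliStar π lift-edge

    lift-touches : ∀ {x t} → x ≢ u′ × x ≢ v′ → ComponentTouches G′ u′ v′ x t →
                   ComponentTouches G (π u′) (π v′) (π x) (π t)
    lift-touches x-off (y , x↝y , yt) with y-off ← ConnectedAvoiding-off G′ x↝y x-off | origin yt
    ... | inj₁ πyt = π y , lift x↝y , πyt
    ... | inj₂ (inj₁ (refl , wt)) = w , lift x↝y ◅◅ (Adj-sym G (hub wt) , π-off y-off , w-off) ◅ ε , wt
    ... | inj₂ (inj₂ (refl , yw)) = w , lift x↝y ◅◅ (yw , π-off y-off , w-off) ◅ ε , hub (Adj-sym G yw)

    lift-BridgeRep : ∀ {x} → BridgeRep G′ u′ v′ x → BridgeRep G (π u′) (π v′) (π x)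
    lift-BridgeRep (x-off , tu , tv) = π-off x-off , lift-touches x-off tu , lift-touches x-off tv

  module Project {u′ v′ τ : Fin m}
    (to-τ : ∀ {j} → Adj G w (π j) → j ≢ u′ → j ≢ v′ → j ≡ τ ⊎ EdgeAvoiding G′ u′ v′ τ j) where

    collapse : Fin (suc m) → Fin m
    collapse v with w ≟ v
    ... | yes _   = τ
    ... | no w≢v = punchOut w≢v

    collapse-w : collapse w ≡ τ
    collapse-w with w ≟ w
    ... | yes _   = refl
    ... | no w≢w = contradiction refl w≢w

    collapse-π : ∀ i → collapse (π i) ≡ i
    collapse-π i with w ≟ π i
    ... | yes w≡πi = contradiction (≡.sym w≡πi) (punchInᵢ≢i w i)
    ... | no _     = trans (punchOut-cong w refl) (punchOut-punchIn w)

    unπ : ∀ {i} → π i ≢ π u′ × π i ≢ π v′ → i ≢ u′ × i ≢ v′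
    unπ (πi≢πu′ , πi≢πv′) = πi≢πu′ ∘ cong π , πi≢πv′ ∘ cong π

    collapse-edge : ∀ {p q} → EdgeAvoiding G (π u′) (π v′) p q →
                    Star (EdgeAvoiding G′ u′ v′) (collapse p) (collapse q)
    collapse-edge {p} {q} (pq , p-off , q-off) with punched? w p | punched? w q
    ... | pivot | pivot = ε
    ... | pivot | punched j rewrite collapse-w | collapse-π j with to-τ pq (proj₁ (unπ q-off)) (proj₂ (unπ q-off))
    ...   | inj₁ j≡τ = subst (Star _ τ) (≡.sym j≡τ) ε
    ...   | inj₂ τj  = τj ◅ ε
    collapse-edge (pq , p-off , q-off) | punched i | pivot rewrite collapse-w | collapse-π i
      with to-τ (Adj-sym G pq) (proj₁ (unπ p-off)) (proj₂ (unπ p-off))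
    ...   | inj₁ i≡τ = subst (λ t → Star _ t τ) (≡.sym i≡τ) ε
    ...   | inj₂ τi  = EdgeAvoiding-sym G′ τi ◅ ε
    collapse-edge (pq , p-off , q-off) | punched i | punched j rewrite collapse-π i | collapse-π j =
      (kept pq , unπ p-off , unπ q-off) ◅ ε

    project : ∀ {x y} → ConnectedAvoiding G (π u′) (π v′) (π x) (π y) → ConnectedAvoiding G′ u′ v′ x y
    project {x} {y} =
      subst₂ (ConnectedAvoiding G′ u′ v′) (collapse-π x) (collapse-π y) ∘ Star.kleisliStar collapse collapse-edge

  other-neighbour : ∀ {j} → Adj G w (π j) → j ≢ α → j ≡ β
  other-neighbour wj j≢α with neighbours wj
  ... | inj₁ πj≡πα = contradiction (punchIn-injective w _ _ πj≡πα) j≢α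
  ... | inj₂ πj≡πβ = punchIn-injective w _ _ πj≡πβ

  collapse-target : ∀ u′ v′ → ∃ λ τ → ∀ {j} → Adj G w (π j) → j ≢ u′ → j ≢ v′ → j ≡ τ ⊎ EdgeAvoiding G′ u′ v′ τ j
  collapse-target u′ v′ with α ≟ u′ | α ≟ v′
  ... | yes refl | _       = β , λ wj j≢α _ → inj₁ (other-neighbour wj j≢α)
  ... | no _     | yes refl = β , λ wj _ j≢α → inj₁ (other-neighbour wj j≢α)
  ... | no α≢u′ | no α≢v′ = α , to-α
    where
    to-α : ∀ {j} → Adj G w (π j) → j ≢ u′ → j ≢ v′ → j ≡ α ⊎ EdgeAvoiding G′ u′ v′ α j
    to-α wj j≢u′ j≢v′ with neighbours wj | α ≟ β
    ... | inj₁ πj≡πα | _ = inj₁ (punchIn-injective w _ _ πj≡πα)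
    ... | inj₂ πj≡πβ | yes α≡β = inj₁ (trans (punchIn-injective w _ _ πj≡πβ) (≡.sym α≡β))
    ... | inj₂ πj≡πβ | no α≢β with refl ← punchIn-injective w _ _ πj≡πβ =
      inj₂ (joined wj α≢β , (α≢u′ , α≢v′) , (j≢u′ , j≢v′))

  project : ∀ {u′ v′ x y} → ConnectedAvoiding G (π u′) (π v′) (π x) (π y) → ConnectedAvoiding G′ u′ v′ x y
  project {u′} {v′} = Project.project (proj₂ (collapse-target u′ v′))

  NoTwoCut-reduced : NoTwoCut G → NoTwoCut G′
  NoTwoCut-reduced noCut u′ v′ (u′≢v′ , x , y , z , (x-rep , y-rep , z-rep) , (¬x↝y , ¬x↝z , ¬y↝z)) =
    noCut (π u′) (π v′) (u′≢v′ ∘ punchIn-injective w _ _ , π x , π y , π z ,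
      (lift-BridgeRep x-rep , lift-BridgeRep y-rep , lift-BridgeRep z-rep) ,
      (¬x↝y ∘ project , ¬x↝z ∘ project , ¬y↝z ∘ project))
    where open Lift

  -- w is a bridge of its own, so a second component of bridges would make {α , β} a nontrivial
  -- 2-cut of G.
  single-bridge : NoTwoCut G → Adj G w (π α) → Adj G w (π β) → α ≢ β → SingleBridge G′ α β
  single-bridge noCut wα wβ α≢β {x} {y} x-rep y-rep with connectedAvoiding? G′ α β x y
  ... | yes x↝y = x↝y
  ... | no ¬x↝y = ⊥-elim (noCut (π α) (π β) (α≢β ∘ punchIn-injective w _ _ , π x , π y , w ,
          (lift-BridgeRep x-rep , lift-BridgeRep y-rep , w-off , (w , ε , wα) , (w , ε , wβ)) ,
          (¬x↝y ∘ project , unreachable-w (punchInᵢ≢i w x) , unreachable-w (punchInᵢ≢i w y))))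
    where
    open Lift
    unreachable-w : ∀ {p} → p ≢ w → ¬ ConnectedAvoiding G (π α) (π β) p w
    unreachable-w p≢w ε = p≢w refl
    unreachable-w {p} p≢w ((pq , (p≢α , p≢β) , _) ◅ q↝w) with _ ≟ w
    ... | no q≢w = unreachable-w q≢w q↝w
    ... | yes refl with neighbours (Adj-sym G pq)
    ...   | inj₁ p≡α = p≢α p≡α
    ...   | inj₂ p≡β = p≢β p≡β

deletion-Reduction : (G : Graph (suc m)) {w : Fin (suc m)} {a : Fin m} →
                     (∀ {x} → Adj G w x → x ≡ punchIn w a) → Reduction G w (deleteVertex G w) a a
deletion-Reduction G {w} only = record
  { kept       = λ πij → πij
  ; origin     = inj₁
  ; neighbours = inj₁ ∘ only
  ; joined     = λ _ a≢a → contradiction refl a≢a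
  ; hub        = λ wx → subst (Adj G w) (only wx) wx
  }

contraction-Reduction : (G : Graph (suc m)) {w : Fin (suc m)} {a b : Fin m} → Adj G w (punchIn w a) →
                        (∀ {x} → Adj G w x → x ≡ punchIn w a ⊎ x ≡ punchIn w b) →
                        Reduction G w (Contract.merged G w a) a b
contraction-Reduction G {w} {a} wa only = record
  { kept       = λ πij → merged-Adj⁺ (λ { refl → Adj-irrefl G πij }) (inj₁ πij)
  ; origin     = merged-Adj⁻
  ; neighbours = only
  ; joined     = λ wb a≢b → merged-Adj⁺ a≢b (inj₂ (inj₁ (refl , wb)))
  ; hub        = λ _ → wa
  }
  where open Contract G w a

-- The induction

Drawable : ℕ → Set
Drawable n = (G : Graph n) → K4MinorFree G → NoTwoCut G → ∃ (Drawing G U)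

draw-degree≤1 : Drawable m → (G : Graph (suc m)) → K4MinorFree G → NoTwoCut G →
                ∀ {w a} → (∀ {x} → Adj G w x → x ≡ punchIn w a) → ∃ (Drawing G U)
draw-degree≤1 draw G free noCut {w} {a} only = inserted , inserted-drawing
  where
  G-w = deleteVertex G w
  D′ = proj₂ (draw G-w (K4MinorFree-◅ (delVertex G w) free) (NoTwoCut-reduced (deletion-Reduction G only) noCut))
  module R = Rotate D′ a
  extreme : ∀ {i} → Adj G w (punchIn w i) → Leftmost U R.rotated i ⊎ Rightmost U R.rotated i
  extreme wi with refl ← punchIn-injective w _ _ (only wi) = inj₁ (R.rotated-leftmost _)
  open Insert {G = G} {w} (λ πij → πij) R.rotated-drawing extreme

draw-degree2 : Drawable m → (G : Graph (suc m)) → K4MinorFree G → NoTwoCut G →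
               ∀ {w a b} → a ≢ b → Adj G w (punchIn w a) → Adj G w (punchIn w b) →
               (∀ {x} → Adj G w x → x ≡ punchIn w a ⊎ x ≡ punchIn w b) → ∃ (Drawing G U)
draw-degree2 draw G free noCut {w} {a} {b} a≢b wa wb only = inserted , inserted-drawing
  where
  H = Contract.merged G w a
  R = contraction-Reduction G wa only
  D-H = proj₂ (draw H (K4MinorFree-◅ (contract G H (Contract.isContraction G w a wa)) free)
                      (NoTwoCut-reduced R noCut))
  ends = ends-extreme
    (Pieces.outer-edge-drawing H (Reduction.joined R wb a≢b) D-H (single-bridge R noCut wa wb a≢b))
  extreme : ∀ {i} → Adj G w (punchIn w i) → Leftmost U (proj₁ ends) i ⊎ Rightmost U (proj₁ ends) i
  extreme = proj₂ (proj₂ ends) ∘ Sum.map (punchIn-injective w _ _) (punchIn-injective w _ _) ∘ only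
  open Insert {G = G} {w} (Reduction.kept R) (proj₁ (proj₂ ends)) extreme

lone-neighbour : (G : Graph (suc (suc m))) {w : Fin (suc (suc m))} → (∀ {x y} → Adj G w x → Adj G w y → x ≡ y) →
                 ∃ λ a → ∀ {x} → Adj G w x → x ≡ punchIn w a
lone-neighbour G {w} at-most-one with any? (λ a → Adj? G w (punchIn w a))
... | yes (a , wa) = a , λ wx → at-most-one wx wa
... | no ¬wa = zero , λ {x} wx → ⊥-elim (isolated wx (punched? w x))
  where
  isolated : ∀ {x} → Adj G w x → ¬ Punched w x
  isolated ww pivot       = Adj-irrefl G ww
  isolated wi (punched i) = ¬wa (i , wi)

draw-step : Drawable (suc m) → Drawable (suc (suc m))
draw-step draw G free noCut with any? (λ w → ¬? (Three? (Adj? G w)))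
... | no ¬low = ⊥-elim (free (K4-MinDegree3 G zero δ))
  where
  δ : MinDegree3 G
  δ v with Three? (Adj? G v)
  ... | yes three = three
  ... | no ¬three = contradiction (v , ¬three) ¬low
... | yes (w , ¬three) with ¬Three⇒AtMostTwo (Adj? G w) ¬three
...   | inj₁ at-most-one with a , only ← lone-neighbour G at-most-one =
  draw-degree≤1 draw G free noCut only
...   | inj₂ (a , b , a≢b , wa , wb , only)
  with a′ , refl ← punchIn-onto (Adj⇒≢ G wa) | b′ , refl ← punchIn-onto (Adj⇒≢ G wb) =
  draw-degree2 draw G free noCut (a≢b ∘ cong (punchIn w)) wa wb only

draw : ∀ n → Drawable n
draw zero G _ _ = (λ ()) , record { injective = λ { {()} } ; noncrossing = λ { {()} } }
draw (suc zero) G _ _ = (λ _ → 0) , record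
  { injective   = λ { {zero} {zero} _ _ _ → refl }
  ; noncrossing = λ _ _ _ _ _ _ (0<0 , _) → <-irrefl refl 0<0
  }
draw (suc (suc m)) = draw-step (draw (suc m))

lemma3p2 : (n : ℕ) (G : Graph n) → K4MinorFree G →
    (∀ (u v : Fin n) → ¬ NontrivialTwoCut G u v) → Outerplanar G
lemma3p2 n G free noCut = Drawing⇒Outerplanar (proj₂ (draw n G free noCut))
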